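{- Let $G=(V,E)$ be a graph, $\varepsilon>0$, $b$ a positive integer, and consider the following random procedure. Let $M_1$ be a fixed $(\varepsilon/4)$-approximately maximal matching in $G$. For each edge of $M_1$ put one endpoint in $L$ and the other in $R$; put each vertex of $V\setminus V(M_1)$ independently and uniformly at random into $L$ or $R$. Let $E_2$ be the set of edges $(u,v)\in E$ with $u\in V(M_1)$, $v\notin V(M_1)$, and $u,v$ on different sides of $(L,R)$. Assign capacity $1$ to vertices of $V(M_1)$ and capacity $b$ to vertices of $V\setminus V(M_1)$, and let $M_2$ be any maximal $b$-matching in $(V,E_2)$ with these capacities. If $|M_1|=\left(\frac12+c\right)\mu(G)$, then $G[M_1\cup M_2]$ contains a set $\mathcal P$ of $3$-augmenting paths with respect to $M_1$ which are pairwise disjoint in their $V(M_1)$ vertices, with $$\mathbb E[|\mathcal P|]\ge\frac{b}{b+1}\left(\frac14\left(\frac12-3c\right)-\frac1b\left(\frac12+c\right)-\frac{7\varepsilon}{8}\right)\mu(G),$$ where the expectation is over the random bipartition.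
   Context: $\mu(G)$ is the maximum matching size; $V(M)$ is the set of endpoints of a matching $M$; $G[F]$ is the subgraph formed by the edge set $F$. A matching $M$ is an $\varepsilon'$-approximately maximal matching if it is inclusion-wise maximal in some subgraph of $G$ obtained by deleting at most $\varepsilon'\mu(G)$ vertices. A $b$-matching with capacities $\{b_v\}$ is a multiset of edges in which each vertex $v$ is in at most $b_v$ elements; maximal means no edge copy can be added while respecting capacities. A $3$-augmenting path w.r.t. $M_1$ is a path $u'-u-v-v'$ with $(u,v)\in M_1$ and $u',v'$ distinct vertices unmatched by $M_1$.
   Formalization: The parameters ε and c range over the rationals. -}

module Defs where

open import Data.Bool using (Bool; true; false; if_then_else_; _∨_; not)
open import Data.Nat using (ℕ; zero; suc; NonZero) renaming (_≤_ to _≤ℕ_; _<_ to _<ℕ_)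
open import Data.Fin using (Fin; _≟_)
open import Data.Fin.Subset using (Subset; _∈_; ∣_∣)
open import Data.Integer using (+_)
open import Data.Rational using (ℚ; _/_; 0ℚ; 1ℚ; ½) renaming (_+_ to _+ℚ_; _*_ to _*ℚ_)
open import Data.List using (List; []; _∷_; length; filterᵇ; concatMap; map; foldr)
open import Data.Bool.ListAction using (any)
open import Data.List.Relation.Unary.Unique.Propositional using (Unique)
open import Data.List.Relation.Unary.AllPairs using (AllPairs)
open import Data.List.Membership.Propositional renaming (_∈_ to _∈L_)
open import Data.Vec using (Vec; lookup; []; _∷_)
open import Data.Product using (_×_; _,_; proj₁; proj₂; Σ; ∃)
open import Data.Sum using (_⊎_)
open import Relation.Nullary using (¬_; does)
open import Relation.Binary.PropositionalEquality using (_≡_; _≢_)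

record Graph (n : ℕ) : Set where
  field
    adj   : Fin n → Fin n → Bool
    sym   : ∀ u v → adj u v ≡ adj v u
    irrefl : ∀ v → adj v v ≡ false
open Graph public

Edge : ℕ → Set
Edge n = Fin n × Fin n

ℕtoℚ : ℕ → ℚ
ℕtoℚ k = + k / 1

endpoints : ∀ {n} → List (Edge n) → List (Fin n)
endpoints = concatMap (λ e → proj₁ e ∷ proj₂ e ∷ [])

isCovered : ∀ {n} → Fin n → List (Edge n) → Bool
isCovered v M = any (λ e → does (v ≟ proj₁ e) ∨ does (v ≟ proj₂ e)) M

deg : ∀ {n} → Fin n → List (Edge n) → ℕ
deg v M = length (filterᵇ (λ e → does (v ≟ proj₁ e) ∨ does (v ≟ proj₂ e)) M)

_∈E_ : ∀ {n} → Edge n → List (Edge n) → Set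
(x , y) ∈E M = ((x , y) ∈L M) ⊎ ((y , x) ∈L M)

IsMatching : ∀ {n} → Graph n → List (Edge n) → Set
IsMatching G M = (∀ {x y} → (x , y) ∈L M → adj G x y ≡ true) × Unique (endpoints M)

IsMaxMatchingSize : ∀ {n} → Graph n → ℕ → Set
IsMaxMatchingSize G m =
  (Σ (List (Edge _)) λ M → IsMatching G M × length M ≡ m) ×
  (∀ M → IsMatching G M → length M ≤ℕ m)

-- M is an ε'-approximately maximal matching of G, where μ = μ(G):
-- there is a set D of at most ε'μ vertices such that M is an inclusion-wise
-- maximal matching of G - D.
IsApproxMaximal : ∀ {n} → Graph n → (μ : ℕ) → (ε' : ℚ) → List (Edge n) → Set
IsApproxMaximal {n} G μ ε' M =
  IsMatching G M ×
  Σ (Subset n) λ D →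
    (ℕtoℚ ∣ D ∣ Data.Rational.≤ (ε' *ℚ ℕtoℚ μ)) ×
    (∀ v → v ∈ D → isCovered v M ≡ false) ×
    (∀ x y → adj G x y ≡ true → ¬ (x ∈ D) → ¬ (y ∈ D) →
       (isCovered x M ≡ true) ⊎ (isCovered y M ≡ true))

-- Side of a vertex in the bipartition (L,R) (true = L, false = R), given the
-- fixed matching M₁ (for each (u,v) ∈ M₁, u goes to L and v to R) and the
-- random bits σ used for the vertices outside V(M₁).
side : ∀ {n} → List (Edge n) → Vec Bool n → Fin n → Bool
side M₁ σ v =
  if any (λ e → does (v ≟ proj₁ e)) M₁ then true
  else if any (λ e → does (v ≟ proj₂ e)) M₁ then false
  else lookup σ v

InE₂ : ∀ {n} → Graph n → List (Edge n) → Vec Bool n → Fin n → Fin n → Set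
InE₂ G M₁ σ x y =
  adj G x y ≡ true ×
  ((isCovered x M₁ ≡ true × isCovered y M₁ ≡ false) ⊎
   (isCovered y M₁ ≡ true × isCovered x M₁ ≡ false)) ×
  side M₁ σ x ≢ side M₁ σ y

cap : ∀ {n} → List (Edge n) → ℕ → Fin n → ℕ
cap M₁ b v = if isCovered v M₁ then 1 else b

IsMaximalBMatching : ∀ {n} → Graph n → List (Edge n) → ℕ → Vec Bool n →
                     List (Edge n) → Set
IsMaximalBMatching G M₁ b σ M₂ =
  (∀ {x y} → (x , y) ∈L M₂ → InE₂ G M₁ σ x y) ×
  (∀ v → deg v M₂ ≤ℕ cap M₁ b v) ×
  -- maximality: adding one more copy of any E₂ edge would exceed a capacity
  (∀ x y → InE₂ G M₁ σ x y →
     (cap M₁ b x <ℕ suc (deg x M₂)) ⊎ (cap M₁ b y <ℕ suc (deg y M₂)))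

-- a path u' - u - v - v' given as a quadruple (u' , u , v , v')
Path3 : ℕ → Set
Path3 n = Fin n × Fin n × Fin n × Fin n

IsAug3In : ∀ {n} → List (Edge n) → List (Edge n) → Path3 n → Set
IsAug3In M₁ M₂ (u' , u , v , v') =
  ((u , v) ∈E M₁) ×
  isCovered u' M₁ ≡ false × isCovered v' M₁ ≡ false × u' ≢ v' ×
  ((u' , u) ∈E M₁ ⊎ (u' , u) ∈E M₂) ×
  ((v , v') ∈E M₁ ⊎ (v , v') ∈E M₂)

DisjointMid : ∀ {n} → Path3 n → Path3 n → Set
DisjointMid (_ , u₁ , v₁ , _) (_ , u₂ , v₂ , _) =
  u₁ ≢ u₂ × u₁ ≢ v₂ × v₁ ≢ u₂ × v₁ ≢ v₂

IsAugFamily : ∀ {n} → List (Edge n) → List (Edge n) → List (Path3 n) → Set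
IsAugFamily M₁ M₂ P =
  (∀ {p} → p ∈L P → IsAug3In M₁ M₂ p) × AllPairs DisjointMid P

allVecs : (n : ℕ) → List (Vec Bool n)
allVecs zero = [] ∷ []
allVecs (suc n) = concatMap (λ v → (true ∷ v) ∷ (false ∷ v) ∷ []) (allVecs n)

powℚ : ℚ → ℕ → ℚ
powℚ q zero = 1ℚ
powℚ q (suc k) = q *ℚ powℚ q k

sumℚ : List ℚ → ℚ
sumℚ = foldr _+ℚ_ 0ℚ

Expect : (n : ℕ) → (Vec Bool n → ℚ) → ℚ
Expect n f = powℚ ½ n *ℚ sumℚ (map f (allVecs n))

module Submission where

-- Fix a maximum matching M*. Call an edge (u,v) of M₁ augmentable if u and v
-- have M*-partners u′, v′ outside V(M₁); these are distinct, and counting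
-- the edges of M* against V(M₁), the deleted set D and these partners gives
-- 2μ ≤ A + 3|M₁| + 2|D| for the number A of augmentable edges. With
-- probability 1/4 the bipartition puts u′ opposite u and v′ opposite v, so
-- that (u,u′) and (v,v′) lie in E₂; call the edge good then, so E[#good] = A/4.
-- By maximality of M₂, a good edge either has both endpoints matched by M₂,
-- which yields a 3-augmenting path, or the partner of an unmatched endpoint
-- is saturated. As M* is a matching, each saturated vertex is blamed at most
-- once, and it carries b edges of M₂, each ending in an M₂-matched vertex of
-- V(M₁); hence b·#good ≤ (b+1)|P| + |M₁|. Taking expectations and
-- substituting |M₁| = (½+c)μ and |D| ≤ εμ/4 gives the bound.

module Sums where

  open import Data.Bool using (Bool; true; false; _∨_)
  open import Data.Nat hiding (_≟_)
  open import Data.Nat.Properties hiding (_≟_)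
  open import Algebra.Properties.CommutativeSemigroup +-commutativeSemigroup using (interchange)
  open import Data.Fin using (Fin; zero; suc; _≟_)
  open import Data.List using (List; []; _∷_; length; _++_; concatMap)
  open import Data.List.Membership.Propositional using (_∈_; _∉_)
  open import Data.List.Relation.Unary.Any using (here; there)
  import Data.List.Relation.Unary.All as All
  open import Data.List.Relation.Unary.Unique.Propositional using (Unique)
  open import Data.List.Relation.Unary.AllPairs using ([]; _∷_)
  open import Algebra.Properties.Semiring.Sum +-*-semiring
    using (sum; ∑-distrib-+; *-distribˡ-sum; sum-cong-≗; sum-replicate-zero)
  open import Relation.Nullary using (yes; no; does)
  open import Relation.Nullary.Negation using (contradiction)
  open import Relation.Binary.PropositionalEquality

  private variable A B : Set

  𝟙 : Bool → ℕ
  𝟙 true = 1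
  𝟙 false = 0

  𝟙≤1 : ∀ b → 𝟙 b ≤ 1
  𝟙≤1 true = ≤-refl
  𝟙≤1 false = z≤n

  𝟙-∨≤+ : ∀ p q → 𝟙 (p ∨ q) ≤ 𝟙 p + 𝟙 q
  𝟙-∨≤+ true q = s≤s z≤n
  𝟙-∨≤+ false q = ≤-refl

  𝟙-≤-∨ˡ : ∀ p q → 𝟙 p ≤ 𝟙 (p ∨ q)
  𝟙-≤-∨ˡ true q = ≤-refl
  𝟙-≤-∨ˡ false q = z≤n

  𝟙-≤-∨ʳ : ∀ p q → 𝟙 q ≤ 𝟙 (p ∨ q)
  𝟙-≤-∨ʳ true q = 𝟙≤1 q
  𝟙-≤-∨ʳ false q = ≤-refl

  sum-mono : ∀ {n} {f g : Fin n → ℕ} → (∀ v → f v ≤ g v) → sum f ≤ sum g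
  sum-mono {zero} f≤g = z≤n
  sum-mono {suc n} f≤g = +-mono-≤ (f≤g zero) (sum-mono (λ v → f≤g (suc v)))

  δ : ∀ {n} → Fin n → Fin n → ℕ
  δ x v = 𝟙 (does (v ≟ x))

  δ-refl-* : ∀ {n} (x : Fin n) k → δ x x * k ≡ k
  δ-refl-* x k with x ≟ x
  ... | yes _ = +-identityʳ k
  ... | no x≢x = contradiction refl x≢x

  δ-sym : ∀ {n} (x v : Fin n) → δ x v ≡ δ v x
  δ-sym x v with v ≟ x | x ≟ v
  ... | yes _  | yes _  = refl
  ... | yes refl | no x≢v = contradiction refl x≢v
  ... | no v≢x | yes refl = contradiction refl v≢x
  ... | no _   | no _   = refl

  sum-δ : ∀ {n} (x : Fin n) (h : Fin n → ℕ) → sum (λ v → δ x v * h v) ≡ h x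
  sum-δ {suc n} zero h =
    trans (cong₂ _+_ (+-identityʳ (h zero)) (sum-replicate-zero n)) (+-identityʳ (h zero))
  sum-δ {suc n} (suc x) h = sum-δ x (λ v → h (suc v))

  ∑ˡ : (A → ℕ) → List A → ℕ
  ∑ˡ f [] = 0
  ∑ˡ f (x ∷ xs) = f x + ∑ˡ f xs

  ∑ˡ-0 : ∀ (xs : List A) → ∑ˡ (λ _ → 0) xs ≡ 0
  ∑ˡ-0 [] = refl
  ∑ˡ-0 (x ∷ xs) = ∑ˡ-0 xs

  ∑ˡ-1 : ∀ (xs : List A) → ∑ˡ (λ _ → 1) xs ≡ length xs
  ∑ˡ-1 [] = refl
  ∑ˡ-1 (x ∷ xs) = cong suc (∑ˡ-1 xs)

  ∑ˡ-+ : ∀ (f g : A → ℕ) xs → ∑ˡ (λ x → f x + g x) xs ≡ ∑ˡ f xs + ∑ˡ g xs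
  ∑ˡ-+ f g [] = refl
  ∑ˡ-+ f g (x ∷ xs) rewrite ∑ˡ-+ f g xs = interchange (f x) (g x) (∑ˡ f xs) (∑ˡ g xs)

  ∑ˡ-*ˡ : ∀ k (f : A → ℕ) xs → ∑ˡ (λ x → k * f x) xs ≡ k * ∑ˡ f xs
  ∑ˡ-*ˡ k f [] = sym (*-zeroʳ k)
  ∑ˡ-*ˡ k f (x ∷ xs) rewrite ∑ˡ-*ˡ k f xs = sym (*-distribˡ-+ k (f x) (∑ˡ f xs))

  ∑ˡ-mono : ∀ {f g : A → ℕ} xs → (∀ x → x ∈ xs → f x ≤ g x) → ∑ˡ f xs ≤ ∑ˡ g xs
  ∑ˡ-mono [] f≤g = z≤n
  ∑ˡ-mono (x ∷ xs) f≤g = +-mono-≤ (f≤g x (here refl)) (∑ˡ-mono xs (λ y y∈ → f≤g y (there y∈)))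

  ∑ˡ-cong : ∀ {f g : A → ℕ} xs → (∀ x → x ∈ xs → f x ≡ g x) → ∑ˡ f xs ≡ ∑ˡ g xs
  ∑ˡ-cong [] f≡g = refl
  ∑ˡ-cong (x ∷ xs) f≡g = cong₂ _+_ (f≡g x (here refl)) (∑ˡ-cong xs (λ y y∈ → f≡g y (there y∈)))

  ≤-∑ˡ : ∀ (f : A → ℕ) {x} xs → x ∈ xs → f x ≤ ∑ˡ f xs
  ≤-∑ˡ f (y ∷ xs) (here refl) = m≤m+n (f y) (∑ˡ f xs)
  ≤-∑ˡ f (y ∷ xs) (there x∈) = ≤-trans (≤-∑ˡ f xs x∈) (m≤n+m (∑ˡ f xs) (f y))

  ∑ˡ-++ : ∀ (f : A → ℕ) xs ys → ∑ˡ f (xs ++ ys) ≡ ∑ˡ f xs + ∑ˡ f ys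
  ∑ˡ-++ f [] ys = refl
  ∑ˡ-++ f (x ∷ xs) ys rewrite ∑ˡ-++ f xs ys = sym (+-assoc (f x) (∑ˡ f xs) (∑ˡ f ys))

  ∑ˡ-concatMap : ∀ (f : B → ℕ) (g : A → List B) xs →
                 ∑ˡ f (concatMap g xs) ≡ ∑ˡ (λ x → ∑ˡ f (g x)) xs
  ∑ˡ-concatMap f g [] = refl
  ∑ˡ-concatMap f g (x ∷ xs) =
    trans (∑ˡ-++ f (g x) (concatMap g xs)) (cong (∑ˡ f (g x) +_) (∑ˡ-concatMap f g xs))

  ∑ˡ-comm : ∀ (F : A → B → ℕ) xs (ys : List B) →
            ∑ˡ (λ x → ∑ˡ (F x) ys) xs ≡ ∑ˡ (λ y → ∑ˡ (λ x → F x y) xs) ys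
  ∑ˡ-comm F [] ys = sym (∑ˡ-0 ys)
  ∑ˡ-comm F (x ∷ xs) ys =
    trans (cong (∑ˡ (F x) ys +_) (∑ˡ-comm F xs ys)) (sym (∑ˡ-+ (F x) (λ y → ∑ˡ (λ x → F x y) xs) ys))

  sum-∑ˡ-comm : ∀ {n} (F : Fin n → A → ℕ) xs →
                sum (λ v → ∑ˡ (F v) xs) ≡ ∑ˡ (λ x → sum (λ v → F v x)) xs
  sum-∑ˡ-comm {n = n} F [] = sum-replicate-zero n
  sum-∑ˡ-comm F (x ∷ xs) =
    trans (∑-distrib-+ (λ v → F v x) (λ v → ∑ˡ (F v) xs)) (cong (sum (λ v → F v x) +_) (sum-∑ˡ-comm F xs))

  module _ {n : ℕ} where

    count : Fin n → List (Fin n) → ℕ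
    count w = ∑ˡ (δ w)

    ∑ˡ-as-sum : ∀ (g : Fin n → ℕ) xs → ∑ˡ g xs ≡ sum (λ w → count w xs * g w)
    ∑ˡ-as-sum g [] = sym (sum-replicate-zero n)
    ∑ˡ-as-sum g (x ∷ xs) = begin
      g x + ∑ˡ g xs
        ≡⟨ cong₂ _+_ (sym (sum-δ x g)) (∑ˡ-as-sum g xs) ⟩
      sum (λ w → δ x w * g w) + sum (λ w → count w xs * g w)
        ≡⟨ sym (∑-distrib-+ (λ w → δ x w * g w) (λ w → count w xs * g w)) ⟩
      sum (λ w → δ x w * g w + count w xs * g w)
        ≡⟨ sum-cong-≗ (λ w → trans (sym (*-distribʳ-+ (g w) (δ x w) (count w xs)))
                                   (cong (λ k → (k + count w xs) * g w) (δ-sym x w))) ⟩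
      sum (λ w → count w (x ∷ xs) * g w) ∎
      where open ≡-Reasoning

    ∈⇒1≤count : ∀ {w} xs → w ∈ xs → 1 ≤ count w xs
    ∈⇒1≤count {w} (x ∷ xs) (here refl) with w ≟ w
    ... | yes _ = s≤s z≤n
    ... | no w≢w = contradiction refl w≢w
    ∈⇒1≤count (x ∷ xs) (there w∈) = ≤-trans (∈⇒1≤count xs w∈) (m≤n+m _ _)

    ∉⇒count≡0 : ∀ {w} xs → w ∉ xs → count w xs ≡ 0
    ∉⇒count≡0 [] w∉ = refl
    ∉⇒count≡0 {w} (x ∷ xs) w∉ with x ≟ w
    ... | yes refl = contradiction (here refl) w∉
    ... | no _ = ∉⇒count≡0 xs (λ w∈ → w∉ (there w∈))

    Unique⇒count≤1 : ∀ {xs} → Unique xs → ∀ w → count w xs ≤ 1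
    Unique⇒count≤1 [] w = z≤n
    Unique⇒count≤1 {x ∷ xs} (x∉ ∷ u) w with x ≟ w
    ... | yes refl = ≤-reflexive (cong suc (∉⇒count≡0 xs (λ x∈ → All.lookup x∉ x∈ refl)))
    ... | no _ = Unique⇒count≤1 u w

    ∑ˡ-Unique≤sum : ∀ (g : Fin n → ℕ) {xs} → Unique xs → ∑ˡ g xs ≤ sum g
    ∑ˡ-Unique≤sum g {xs} u = begin
      ∑ˡ g xs                         ≡⟨ ∑ˡ-as-sum g xs ⟩
      sum (λ w → count w xs * g w)    ≤⟨ sum-mono (λ w → ≤-trans (*-monoˡ-≤ (g w) (Unique⇒count≤1 u w))
                                                                 (≤-reflexive (*-identityˡ (g w)))) ⟩
      sum g                           ∎
      where open ≤-Reasoning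

    sum-restricted≤∑ˡ : ∀ (P : Fin n → Bool) (h : Fin n → ℕ) xs → (∀ w → P w ≡ true → w ∈ xs) →
                        sum (λ w → 𝟙 (P w) * h w) ≤ ∑ˡ h xs
    sum-restricted≤∑ˡ P h xs P⊆xs = begin
      sum (λ w → 𝟙 (P w) * h w)       ≤⟨ sum-mono 𝟙P≤count ⟩
      sum (λ w → count w xs * h w)    ≡⟨ sym (∑ˡ-as-sum h xs) ⟩
      ∑ˡ h xs                         ∎
      where
      open ≤-Reasoning
      𝟙P≤count : ∀ w → 𝟙 (P w) * h w ≤ count w xs * h w
      𝟙P≤count w with P w in Pw
      ... | true = *-monoˡ-≤ (h w) (∈⇒1≤count xs (P⊆xs w Pw))
      ... | false = z≤n

module BitVectors where

  open import Defs using (allVecs)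
  open Sums
  open import Data.Bool using (Bool; true; false; _∧_; _xor_)
  open import Data.Nat hiding (_≟_)
  open import Data.Nat.Properties hiding (_≟_)
  open import Data.Fin using (Fin; zero; suc)
  open import Data.Vec using (Vec; _∷_; lookup)
  open import Relation.Nullary.Negation using (contradiction)
  open import Relation.Binary.PropositionalEquality

  ∑ˡ-allVecs-suc : ∀ n (f : Vec Bool (suc n) → ℕ) →
                   ∑ˡ f (allVecs (suc n)) ≡ ∑ˡ (λ σ → f (true ∷ σ) + f (false ∷ σ)) (allVecs n)
  ∑ˡ-allVecs-suc n f = trans (∑ˡ-concatMap f _ (allVecs n))
                             (∑ˡ-cong (allVecs n) (λ σ _ → cong (f (true ∷ σ) +_) (+-identityʳ (f (false ∷ σ)))))

  ∑ˡ-allVecs-double : ∀ n (f : Vec Bool n → ℕ) →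
                      ∑ˡ (λ σ → f σ + f σ) (allVecs n) ≡ 2 * ∑ˡ f (allVecs n)
  ∑ˡ-allVecs-double n f =
    trans (∑ˡ-+ f f (allVecs n)) (cong (∑ˡ f (allVecs n) +_) (sym (+-identityʳ (∑ˡ f (allVecs n)))))

  ∑ˡ-1-allVecs : ∀ n → ∑ˡ (λ _ → 1) (allVecs n) ≡ 2 ^ n
  ∑ˡ-1-allVecs zero = refl
  ∑ˡ-1-allVecs (suc n) = begin
    ∑ˡ (λ _ → 1) (allVecs (suc n))    ≡⟨ ∑ˡ-allVecs-suc n (λ _ → 1) ⟩
    ∑ˡ (λ _ → 1 + 1) (allVecs n)       ≡⟨ ∑ˡ-allVecs-double n (λ _ → 1) ⟩
    2 * ∑ˡ (λ _ → 1) (allVecs n)       ≡⟨ cong (2 *_) (∑ˡ-1-allVecs n) ⟩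
    2 ^ suc n                          ∎
    where open ≡-Reasoning

  𝟙-xor-split : ∀ α → 𝟙 (α xor true) + 𝟙 (α xor false) ≡ 1
  𝟙-xor-split true = refl
  𝟙-xor-split false = refl

  count-bit≢ : ∀ n (i : Fin n) α → 2 * ∑ˡ (λ σ → 𝟙 (α xor lookup σ i)) (allVecs n) ≡ 2 ^ n
  count-bit≢ (suc n) zero α = cong (2 *_) (begin
    ∑ˡ (λ σ → 𝟙 (α xor lookup σ zero)) (allVecs (suc n))  ≡⟨ ∑ˡ-allVecs-suc n _ ⟩
    ∑ˡ (λ _ → 𝟙 (α xor true) + 𝟙 (α xor false)) (allVecs n)  ≡⟨ cong (λ k → ∑ˡ (λ _ → k) (allVecs n)) (𝟙-xor-split α) ⟩
    ∑ˡ (λ _ → 1) (allVecs n)                                ≡⟨ ∑ˡ-1-allVecs n ⟩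
    2 ^ n                                                   ∎)
    where open ≡-Reasoning
  count-bit≢ (suc n) (suc i) α = begin
    2 * ∑ˡ (λ σ → 𝟙 (α xor lookup σ (suc i))) (allVecs (suc n))  ≡⟨ cong (2 *_) (∑ˡ-allVecs-suc n _) ⟩
    2 * ∑ˡ (λ σ → f σ + f σ) (allVecs n)                          ≡⟨ cong (2 *_) (∑ˡ-allVecs-double n f) ⟩
    2 * (2 * ∑ˡ f (allVecs n))                                    ≡⟨ cong (2 *_) (count-bit≢ n i α) ⟩
    2 ^ suc n                                                     ∎
    where
    open ≡-Reasoning
    f : Vec Bool n → ℕ
    f σ = 𝟙 (α xor lookup σ i)

  count-bits≢ : ∀ n (i j : Fin n) → i ≢ j → ∀ α β →
                4 * ∑ˡ (λ σ → 𝟙 ((α xor lookup σ i) ∧ (β xor lookup σ j))) (allVecs n) ≡ 2 ^ n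
  count-bits≢ (suc n) zero zero i≢j α β = contradiction refl i≢j
  count-bits≢ (suc n) zero (suc j) i≢j α β = begin
    4 * ∑ˡ _ (allVecs (suc n))                          ≡⟨ cong (4 *_) (∑ˡ-allVecs-suc n _) ⟩
    4 * ∑ˡ (λ σ → 𝟙 ((α xor true) ∧ f σ) + 𝟙 ((α xor false) ∧ f σ)) (allVecs n)
      ≡⟨ cong (4 *_) (∑ˡ-cong (allVecs n) (λ σ _ → split α (f σ))) ⟩
    4 * ∑ˡ (λ σ → 𝟙 (f σ)) (allVecs n)                  ≡⟨ *-assoc 2 2 (∑ˡ (λ σ → 𝟙 (f σ)) (allVecs n)) ⟩
    2 * (2 * ∑ˡ (λ σ → 𝟙 (f σ)) (allVecs n))            ≡⟨ cong (2 *_) (count-bit≢ n j β) ⟩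
    2 ^ suc n                                           ∎
    where
    open ≡-Reasoning
    f : Vec Bool n → Bool
    f σ = β xor lookup σ j
    split : ∀ α b → 𝟙 ((α xor true) ∧ b) + 𝟙 ((α xor false) ∧ b) ≡ 𝟙 b
    split true b = refl
    split false b = +-identityʳ (𝟙 b)
  count-bits≢ (suc n) (suc i) zero i≢j α β = begin
    4 * ∑ˡ _ (allVecs (suc n))                          ≡⟨ cong (4 *_) (∑ˡ-allVecs-suc n _) ⟩
    4 * ∑ˡ (λ σ → 𝟙 (f σ ∧ (β xor true)) + 𝟙 (f σ ∧ (β xor false))) (allVecs n)
      ≡⟨ cong (4 *_) (∑ˡ-cong (allVecs n) (λ σ _ → split (f σ) β)) ⟩
    4 * ∑ˡ (λ σ → 𝟙 (f σ)) (allVecs n)                  ≡⟨ *-assoc 2 2 (∑ˡ (λ σ → 𝟙 (f σ)) (allVecs n)) ⟩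
    2 * (2 * ∑ˡ (λ σ → 𝟙 (f σ)) (allVecs n))            ≡⟨ cong (2 *_) (count-bit≢ n i α) ⟩
    2 ^ suc n                                           ∎
    where
    open ≡-Reasoning
    f : Vec Bool n → Bool
    f σ = α xor lookup σ i
    split : ∀ b β → 𝟙 (b ∧ (β xor true)) + 𝟙 (b ∧ (β xor false)) ≡ 𝟙 b
    split true true = refl
    split true false = refl
    split false β = refl
  count-bits≢ (suc n) (suc i) (suc j) i≢j α β = begin
    4 * ∑ˡ _ (allVecs (suc n))                  ≡⟨ cong (4 *_) (∑ˡ-allVecs-suc n _) ⟩
    4 * ∑ˡ (λ σ → f σ + f σ) (allVecs n)        ≡⟨ cong (4 *_) (∑ˡ-allVecs-double n f) ⟩
    4 * (2 * ∑ˡ f (allVecs n))                  ≡⟨ trans (sym (*-assoc 4 2 (∑ˡ f (allVecs n)))) (*-assoc 2 4 (∑ˡ f (allVecs n))) ⟩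
    2 * (4 * ∑ˡ f (allVecs n))                  ≡⟨ cong (2 *_) (count-bits≢ n i j (λ i≡j → i≢j (cong suc i≡j)) α β) ⟩
    2 ^ suc n                                   ∎
    where
    open ≡-Reasoning
    f : Vec Bool n → ℕ
    f σ = 𝟙 ((α xor lookup σ i) ∧ (β xor lookup σ j))

module EdgeLists where

  open import Defs hiding (sym)
  open Sums
  open import Data.Bool using (Bool; true; false; _∨_; _∧_; if_then_else_)
  open import Data.Bool.Properties using (∨-zeroʳ)
  open import Data.Bool.ListAction using (any)
  open import Data.Nat hiding (_≟_)
  open import Data.Nat.Properties hiding (_≟_)
  open import Algebra.Properties.Semiring.Sum +-*-semiring using (sum; sum-cong-≗; ∑-distrib-+)
  open import Data.Fin using (Fin; _≟_)
  open import Data.List using (List; []; _∷_)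
  open import Data.List.Membership.Propositional using () renaming (_∈_ to _∈L_)
  open import Data.List.Relation.Unary.Any using (here; there)
  import Data.List.Relation.Unary.All as All
  open import Data.List.Relation.Unary.AllPairs using (_∷_)
  open import Data.List.Relation.Unary.Unique.Propositional using (Unique)
  open import Data.Maybe using (Maybe; just; nothing; is-just)
  open import Data.Product using (_×_; _,_; proj₁; proj₂; ∃-syntax)
  open import Data.Sum using (_⊎_; inj₁; inj₂)
  open import Data.Vec using (Vec; lookup)
  open import Function using (_∘_)
  open import Relation.Nullary using (yes; no; does; ¬_)
  open import Relation.Nullary.Negation using (contradiction)
  open import Relation.Binary.PropositionalEquality

  ∨≡true : ∀ {a b} → a ∨ b ≡ true → a ≡ true ⊎ b ≡ true
  ∨≡true {true} _ = inj₁ refl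
  ∨≡true {false} b≡true = inj₂ b≡true

  ∧≡true : ∀ {a b} → a ∧ b ≡ true → a ≡ true × b ≡ true
  ∧≡true {true} {true} _ = refl , refl

  module _ {n : ℕ} where

    does-≟-refl : ∀ (x : Fin n) → does (x ≟ x) ≡ true
    does-≟-refl x with x ≟ x
    ... | yes _ = refl
    ... | no x≢x = contradiction refl x≢x

    does-≟⇒≡ : ∀ {x y : Fin n} → does (x ≟ y) ≡ true → x ≡ y
    does-≟⇒≡ {x} {y} _ with x ≟ y
    does-≟⇒≡ _  | yes x≡y = x≡y
    does-≟⇒≡ () | no _

    any≡true⇒∃ : ∀ (p : Edge n → Bool) M → any p M ≡ true → ∃[ e ] e ∈L M × p e ≡ true
    any≡true⇒∃ p (e ∷ M) any≡true with p e in pe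
    ... | true = e , here refl , pe
    ... | false with any≡true⇒∃ p M any≡true
    ...   | e′ , e′∈M , pe′ = e′ , there e′∈M , pe′

    ∃⇒any≡true : ∀ (p : Edge n → Bool) {M e} → e ∈L M → p e ≡ true → any p M ≡ true
    ∃⇒any≡true p {e ∷ M} (here refl) pe rewrite pe = refl
    ∃⇒any≡true p {e′ ∷ M} (there e∈M) pe with p e′
    ... | true = refl
    ... | false = ∃⇒any≡true p e∈M pe

    ∑ˡ-endpoints : ∀ (h : Fin n → ℕ) M → ∑ˡ h (endpoints M) ≡ ∑ˡ (λ e → h (proj₁ e) + h (proj₂ e)) M
    ∑ˡ-endpoints h [] = refl
    ∑ˡ-endpoints h ((x , y) ∷ M) rewrite ∑ˡ-endpoints h M = sym (+-assoc (h x) (h y) _)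

    ∈-endpoints₁ : ∀ {x y : Fin n} {M : List (Edge n)} → (x , y) ∈L M → x ∈L endpoints M
    ∈-endpoints₁ (here refl) = here refl
    ∈-endpoints₁ (there e∈M) = there (there (∈-endpoints₁ e∈M))

    ∈-endpoints₂ : ∀ {x y : Fin n} {M : List (Edge n)} → (x , y) ∈L M → y ∈L endpoints M
    ∈-endpoints₂ (here refl) = there (here refl)
    ∈-endpoints₂ (there e∈M) = there (there (∈-endpoints₂ e∈M))

    isCovered⇒∈endpoints : ∀ {w} M → isCovered w M ≡ true → w ∈L endpoints M
    isCovered⇒∈endpoints {w} M covered with any≡true⇒∃ _ M covered
    ... | (x , y) , e∈M , w∈e with ∨≡true {does (w ≟ x)} w∈e
    ...   | inj₁ w≡x = subst (_∈L endpoints M) (sym (does-≟⇒≡ w≡x)) (∈-endpoints₁ e∈M)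
    ...   | inj₂ w≡y = subst (_∈L endpoints M) (sym (does-≟⇒≡ w≡y)) (∈-endpoints₂ e∈M)

    isCovered-fst : ∀ {u v : Fin n} {M : List (Edge n)} → (u , v) ∈L M → isCovered u M ≡ true
    isCovered-fst {u} {v} e∈M = ∃⇒any≡true _ e∈M (cong (_∨ does (u ≟ v)) (does-≟-refl u))

    isCovered-snd : ∀ {u v : Fin n} {M : List (Edge n)} → (u , v) ∈L M → isCovered v M ≡ true
    isCovered-snd {u} {v} e∈M = ∃⇒any≡true _ e∈M (trans (cong (does (v ≟ u) ∨_) (does-≟-refl v)) (∨-zeroʳ _))

    IsEndpoint : Fin n → Edge n → Set
    IsEndpoint w (x , y) = w ≡ x ⊎ w ≡ y

    incident : Fin n → Edge n → ℕ
    incident w e = 𝟙 (does (w ≟ proj₁ e) ∨ does (w ≟ proj₂ e))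

    sum-incident≤ : ∀ (P : Fin n → ℕ) x y → sum (λ w → P w * incident w (x , y)) ≤ P x + P y
    sum-incident≤ P x y = begin
      sum (λ w → P w * incident w (x , y))           ≤⟨ sum-mono (λ w → *-monoʳ-≤ (P w) (𝟙-∨≤+ (does (w ≟ x)) _)) ⟩
      sum (λ w → P w * (δ x w + δ y w))              ≡⟨ sum-cong-≗ (λ w → trans (*-distribˡ-+ (P w) (δ x w) (δ y w))
                                                         (cong₂ _+_ (*-comm (P w) (δ x w)) (*-comm (P w) (δ y w)))) ⟩
      sum (λ w → δ x w * P w + δ y w * P w)          ≡⟨ ∑-distrib-+ (λ w → δ x w * P w) (λ w → δ y w * P w) ⟩
      sum (λ w → δ x w * P w) + sum (λ w → δ y w * P w)  ≡⟨ cong₂ _+_ (sum-δ x P) (sum-δ y P) ⟩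
      P x + P y                                      ∎
      where open ≤-Reasoning

    ≤-sum-incident : ∀ (P : Fin n → ℕ) {x} e → IsEndpoint x e → P x ≤ sum (λ w → P w * incident w e)
    ≤-sum-incident P {x} e x∈e = begin
      P x                          ≡⟨ sym (sum-δ x P) ⟩
      sum (λ w → δ x w * P w)      ≤⟨ sum-mono (λ w → ≤-trans (≤-reflexive (*-comm (δ x w) (P w)))
                                                              (*-monoʳ-≤ (P w) (δ≤incident w x∈e))) ⟩
      sum (λ w → P w * incident w e) ∎
      where
      open ≤-Reasoning
      δ≤incident : ∀ w {x e} → IsEndpoint x e → δ x w ≤ incident w e
      δ≤incident w (inj₁ refl) = 𝟙-≤-∨ˡ _ _
      δ≤incident w (inj₂ refl) = 𝟙-≤-∨ʳ _ _

    deg≡∑ˡ : ∀ (w : Fin n) M → deg w M ≡ ∑ˡ (incident w) M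
    deg≡∑ˡ w [] = refl
    deg≡∑ˡ w ((x , y) ∷ M) with does (w ≟ x) ∨ does (w ≟ y)
    ... | true = cong suc (deg≡∑ˡ w M)
    ... | false = deg≡∑ˡ w M

    swap-∈E : ∀ {x y : Fin n} {M : List (Edge n)} → (x , y) ∈E M → (y , x) ∈E M
    swap-∈E (inj₁ xy∈M) = inj₂ xy∈M
    swap-∈E (inj₂ yx∈M) = inj₁ yx∈M

    adj-∈E : ∀ {G : Graph n} {M : List (Edge n)} → IsMatching G M → ∀ {x y : Fin n} → (x , y) ∈E M → adj G x y ≡ true
    adj-∈E M-matching (inj₁ xy∈M) = proj₁ M-matching xy∈M
    adj-∈E {G} M-matching {x} {y} (inj₂ yx∈M) = trans (Graph.sym G x y) (proj₁ M-matching yx∈M)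

    adj⇒≢ : ∀ {G : Graph n} {u v : Fin n} → adj G u v ≡ true → u ≢ v
    adj⇒≢ {G} {u} uv refl with () ← trans (sym uv) (irrefl G u)

    head-endpoint∉tail : ∀ {x y : Fin n} {M e w} → Unique (endpoints ((x , y) ∷ M)) →
                         e ∈L M → IsEndpoint w (x , y) → ¬ IsEndpoint w e
    head-endpoint∉tail (x∉ ∷ y∉ ∷ _) e∈M (inj₁ refl) (inj₁ refl) = All.lookup x∉ (there (∈-endpoints₁ e∈M)) refl
    head-endpoint∉tail (x∉ ∷ y∉ ∷ _) e∈M (inj₁ refl) (inj₂ refl) = All.lookup x∉ (there (∈-endpoints₂ e∈M)) refl
    head-endpoint∉tail (x∉ ∷ y∉ ∷ _) e∈M (inj₂ refl) (inj₁ refl) = All.lookup y∉ (∈-endpoints₁ e∈M) refl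
    head-endpoint∉tail (x∉ ∷ y∉ ∷ _) e∈M (inj₂ refl) (inj₂ refl) = All.lookup y∉ (∈-endpoints₂ e∈M) refl

    Unique-endpoints⇒edge≡ : ∀ {M : List (Edge n)} → Unique (endpoints M) → ∀ {e₁ e₂ w} →
                             e₁ ∈L M → e₂ ∈L M → IsEndpoint w e₁ → IsEndpoint w e₂ → e₁ ≡ e₂
    Unique-endpoints⇒edge≡ _ (here refl) (here refl) _ _ = refl
    Unique-endpoints⇒edge≡ u (here refl) (there e₂∈M) w∈e₁ w∈e₂ = contradiction w∈e₂ (head-endpoint∉tail u e₂∈M w∈e₁)
    Unique-endpoints⇒edge≡ u (there e₁∈M) (here refl) w∈e₁ w∈e₂ = contradiction w∈e₁ (head-endpoint∉tail u e₁∈M w∈e₂)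
    Unique-endpoints⇒edge≡ (_ ∷ _ ∷ u) (there e₁∈M) (there e₂∈M) w∈e₁ w∈e₂ =
      Unique-endpoints⇒edge≡ u e₁∈M e₂∈M w∈e₁ w∈e₂

    matching-partner-unique : ∀ {M : List (Edge n)} → Unique (endpoints M) → ∀ {u v z} →
                              (u , z) ∈E M → (v , z) ∈E M → u ≡ v
    matching-partner-unique unique (inj₁ p) (inj₁ q) = cong proj₁ (Unique-endpoints⇒edge≡ unique p q (inj₂ refl) (inj₂ refl))
    matching-partner-unique unique (inj₁ p) (inj₂ q) =
      let uz≡zv = Unique-endpoints⇒edge≡ unique p q (inj₂ refl) (inj₁ refl) in trans (cong proj₁ uz≡zv) (cong proj₂ uz≡zv)
    matching-partner-unique unique (inj₂ p) (inj₁ q) =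
      let zu≡vz = Unique-endpoints⇒edge≡ unique p q (inj₁ refl) (inj₂ refl) in trans (cong proj₂ zu≡vz) (cong proj₁ zu≡vz)
    matching-partner-unique unique (inj₂ p) (inj₂ q) = cong proj₂ (Unique-endpoints⇒edge≡ unique p q (inj₁ refl) (inj₁ refl))

    partner : (Fin n → Bool) → Fin n → List (Edge n) → Maybe (Fin n)
    partner q w [] = nothing
    partner q w ((x , y) ∷ M) =
      if does (w ≟ x) ∧ q y then just y
      else if does (w ≟ y) ∧ q x then just x
      else partner q w M

    partner-sound : ∀ q w M {z} → partner q w M ≡ just z → (w , z) ∈E M × q z ≡ true
    partner-sound q w ((x , y) ∷ M) found with does (w ≟ x) ∧ q y in wx
    partner-sound q w ((x , y) ∷ M) refl | true with ∧≡true {does (w ≟ x)} wx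
    ... | w≡x , qy = inj₁ (here (cong (_, y) (does-≟⇒≡ w≡x))) , qy
    partner-sound q w ((x , y) ∷ M) found | false with does (w ≟ y) ∧ q x in wy
    partner-sound q w ((x , y) ∷ M) refl | false | true with ∧≡true {does (w ≟ y)} wy
    ... | w≡y , qx = inj₂ (here (cong (x ,_) (does-≟⇒≡ w≡y))) , qx
    partner-sound q w ((x , y) ∷ M) found | false | false with partner-sound q w M found
    ... | inj₁ wz∈M , qz = inj₁ (there wz∈M) , qz
    ... | inj₂ zw∈M , qz = inj₂ (there zw∈M) , qz

    partner-complete : ∀ q w M {z} → (w , z) ∈E M → q z ≡ true → is-just (partner q w M) ≡ true
    partner-complete q w [] (inj₁ ()) qz
    partner-complete q w [] (inj₂ ()) qz
    partner-complete q w ((x , y) ∷ M) wz∈M qz with does (w ≟ x) ∧ q y in wx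
    ... | true = refl
    ... | false with does (w ≟ y) ∧ q x in wy
    ...   | true = refl
    partner-complete q w ((x , y) ∷ M) (inj₁ (here refl)) qz | false | false
      rewrite does-≟-refl w | qz with () ← wx
    partner-complete q w ((x , y) ∷ M) (inj₂ (here refl)) qz | false | false
      rewrite does-≟-refl w | qz with () ← wy
    partner-complete q w ((x , y) ∷ M) (inj₁ (there wz∈M)) qz | false | false =
      partner-complete q w M (inj₁ wz∈M) qz
    partner-complete q w ((x , y) ∷ M) (inj₂ (there zw∈M)) qz | false | false =
      partner-complete q w M (inj₂ zw∈M) qz

    no-partner⇒deg≡0 : ∀ w M → partner (λ _ → true) w M ≡ nothing → deg w M ≡ 0
    no-partner⇒deg≡0 w [] _ = refl
    no-partner⇒deg≡0 w ((x , y) ∷ M) none with does (w ≟ x) | does (w ≟ y)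
    ... | false | false = no-partner⇒deg≡0 w M none

    module _ {M₁ : List (Edge n)} (σ : Vec Bool n) where

      side-fst : ∀ {u v} → (u , v) ∈L M₁ → side M₁ σ u ≡ true
      side-fst {u} uv∈M₁ rewrite ∃⇒any≡true (λ e → does (u ≟ proj₁ e)) uv∈M₁ (does-≟-refl u) = refl

      side-snd : ∀ {G} → IsMatching G M₁ → ∀ {u v} → (u , v) ∈L M₁ → side M₁ σ v ≡ false
      side-snd {G} M₁-matching {u} {v} uv∈M₁ with any (λ e → does (v ≟ proj₁ e)) M₁ in v-fst
      ... | false rewrite ∃⇒any≡true (λ e → does (v ≟ proj₂ e)) uv∈M₁ (does-≟-refl v) = refl
      ... | true with any≡true⇒∃ _ M₁ v-fst
      ...   | (x , y) , xy∈M₁ , v≡x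
        with refl ← Unique-endpoints⇒edge≡ (proj₂ M₁-matching) uv∈M₁ xy∈M₁ (inj₂ refl) (inj₁ (does-≟⇒≡ v≡x))
        = contradiction (does-≟⇒≡ v≡x) (adj⇒≢ {G = G} (proj₁ M₁-matching uv∈M₁) ∘ sym)

      side-free : ∀ {w} → isCovered w M₁ ≡ false → side M₁ σ w ≡ lookup σ w
      side-free {w} uncovered with any (λ e → does (w ≟ proj₁ e)) M₁ in w-fst
      ... | true with e , e∈M₁ , w≡e₁ ← any≡true⇒∃ _ M₁ w-fst
        with () ← trans (sym uncovered) (∃⇒any≡true _ e∈M₁ (cong (_∨ does (w ≟ proj₂ e)) w≡e₁))
      ... | false with any (λ e → does (w ≟ proj₂ e)) M₁ in w-snd
      ...   | true with e , e∈M₁ , w≡e₂ ← any≡true⇒∃ _ M₁ w-snd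
        with () ← trans (sym uncovered) (∃⇒any≡true _ e∈M₁ (trans (cong (does (w ≟ proj₁ e) ∨_) w≡e₂) (∨-zeroʳ _)))
      ...   | false = refl

    sum-covered≤∑ˡ : ∀ (h : Fin n → ℕ) M →
                     sum (λ w → 𝟙 (isCovered w M) * h w) ≤ ∑ˡ (λ e → h (proj₁ e) + h (proj₂ e)) M
    sum-covered≤∑ˡ h M = ≤-trans (sum-restricted≤∑ˡ (λ w → isCovered w M) h (endpoints M) (λ w → isCovered⇒∈endpoints M))
                                 (≤-reflexive (∑ˡ-endpoints h M))

    sum-*-deg : ∀ (P : Fin n → ℕ) M → sum (λ w → P w * deg w M) ≡ ∑ˡ (λ e → sum (λ w → P w * incident w e)) M
    sum-*-deg P M = trans (sum-cong-≗ (λ w → trans (cong (P w *_) (deg≡∑ˡ w M)) (sym (∑ˡ-*ˡ (P w) (incident w) M))))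
                          (sum-∑ˡ-comm (λ w e → P w * incident w e) M)

module FreePartnerAnalysis where

  open import Defs hiding (sym)
  open Sums
  open BitVectors
  open EdgeLists
  open import Data.Bool using (Bool; true; false; _∧_; not; if_then_else_; _xor_; T)
  open import Data.Nat
  open import Data.Nat.Properties
  open import Algebra.Properties.Semiring.Sum +-*-semiring using (sum; ∑-distrib-+; *-distribˡ-sum; sum-cong-≗)
  open import Data.Fin using (Fin)
  open import Data.Fin.Subset using (Subset; ∣_∣) renaming (_∈_ to _∈S_)
  open import Data.Vec using (Vec; []; _∷_; lookup)
  open import Data.Vec.Properties using ([]=⇒lookup)
  open import Data.List using (List; []; _∷_; length)
  open import Data.List.Membership.Propositional using () renaming (_∈_ to _∈L_)
  open import Data.Maybe using (Maybe; just; nothing; is-just; maybe′)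
  open import Data.Product using (_×_; _,_; proj₁; proj₂; map)
  open import Data.List.Relation.Unary.Any using (here; there)
  import Data.List.Relation.Unary.All as All
  open import Data.List.Relation.Unary.AllPairs using (AllPairs; []; _∷_)
  open import Data.List.Relation.Unary.Unique.Propositional using (Unique)
  open import Data.Sum using (_⊎_; inj₁; inj₂; swap)
  open import Data.Bool.Properties using (not-injective; ¬-not; T-≡)
  open import Function.Bundles using (Equivalence)
  open import Function using (_∘_; case_of_)
  open import Relation.Nullary using (¬_)
  open import Relation.Nullary.Negation using (contradiction)
  open import Relation.Binary.PropositionalEquality

  +≤*+1 : ∀ {x y} → x ≤ 1 → y ≤ 1 → x + y ≤ x * y + 1
  +≤*+1 {zero} _ y≤1 = y≤1
  +≤*+1 {suc zero} {zero} _ _ = s≤s z≤n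
  +≤*+1 {suc zero} {suc zero} _ _ = ≤-refl
  +≤*+1 {suc zero} {suc (suc _)} _ (s≤s ())
  +≤*+1 {suc (suc _)} (s≤s ()) _

  ∣p∣≡sum : ∀ {n} (p : Subset n) → ∣ p ∣ ≡ sum (λ w → 𝟙 (lookup p w))
  ∣p∣≡sum [] = refl
  ∣p∣≡sum (true ∷ p) = cong suc (∣p∣≡sum p)
  ∣p∣≡sum (false ∷ p) = ∣p∣≡sum p

  lookup≡false⇒∉ : ∀ {n} {D : Subset n} {w} → lookup D w ≡ false → ¬ (w ∈S D)
  lookup≡false⇒∉ wlookup≡false⇒∉ w∈D with () ← trans (sym ([]=⇒lookup w∈D)) wlookup≡false⇒∉

  module FreePartners {n} (G : Graph n) (M₁ : List (Edge n)) (M₁-matching : IsMatching G M₁)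
                      (M* : List (Edge n)) (M*-matching : IsMatching G M*) where

    covered : Fin n → Bool
    covered w = isCovered w M₁

    freePartner : Fin n → Maybe (Fin n)
    freePartner w = partner (λ z → not (covered z)) w M*

    hasFreePartner : Fin n → ℕ
    hasFreePartner w = 𝟙 (is-just (freePartner w))

    augmentable : ℕ
    augmentable = ∑ˡ (λ e → hasFreePartner (proj₁ e) * hasFreePartner (proj₂ e)) M₁

    freePartner-sound : ∀ w {z} → freePartner w ≡ just z → (w , z) ∈E M* × covered z ≡ false
    freePartner-sound w found with partner-sound _ w M* found
    ... | wz∈M* , z-free = wz∈M* , not-injective z-free

    sum-covered≤∑ˡ*+∣M₁∣ : ∀ (h : Fin n → ℕ) → (∀ w → h w ≤ 1) →
                  sum (λ w → 𝟙 (covered w) * h w) ≤ ∑ˡ (λ e → h (proj₁ e) * h (proj₂ e)) M₁ + length M₁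
    sum-covered≤∑ˡ*+∣M₁∣ h h≤1 = begin
      sum (λ w → 𝟙 (covered w) * h w)               ≤⟨ sum-covered≤∑ˡ h M₁ ⟩
      ∑ˡ (λ e → h (proj₁ e) + h (proj₂ e)) M₁        ≤⟨ ∑ˡ-mono M₁ (λ e _ → +≤*+1 (h≤1 (proj₁ e)) (h≤1 (proj₂ e))) ⟩
      ∑ˡ (λ e → h (proj₁ e) * h (proj₂ e) + 1) M₁    ≡⟨ ∑ˡ-+ _ (λ _ → 1) M₁ ⟩
      ∑ˡ (λ e → h (proj₁ e) * h (proj₂ e)) M₁ + ∑ˡ (λ _ → 1) M₁  ≡⟨ cong (∑ˡ (λ e → h (proj₁ e) * h (proj₂ e)) M₁ +_) (∑ˡ-1 M₁) ⟩
      ∑ˡ (λ e → h (proj₁ e) * h (proj₂ e)) M₁ + length M₁ ∎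
      where open ≤-Reasoning

    sum-covered≤2∣M₁∣ : sum (λ w → 𝟙 (covered w)) ≤ 2 * length M₁
    sum-covered≤2∣M₁∣ = begin
      sum (λ w → 𝟙 (covered w))                      ≡⟨ sum-cong-≗ (λ w → sym (*-identityʳ (𝟙 (covered w)))) ⟩
      sum (λ w → 𝟙 (covered w) * 1)                  ≤⟨ sum-covered≤∑ˡ (λ _ → 1) M₁ ⟩
      ∑ˡ (λ _ → 2) M₁                                ≡⟨ ∑ˡ-*ˡ 2 (λ _ → 1) M₁ ⟩
      2 * ∑ˡ (λ _ → 1) M₁                            ≡⟨ cong (2 *_) (∑ˡ-1 M₁) ⟩
      2 * length M₁                                  ∎
      where open ≤-Reasoning

    module Tokens (D : Subset n)
                  (maximal-off-D : ∀ x y → adj G x y ≡ true → ¬ (x ∈S D) → ¬ (y ∈S D) →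
                                   (covered x ≡ true) ⊎ (covered y ≡ true)) where

      tokens : Fin n → ℕ
      tokens w = 𝟙 (covered w) * hasFreePartner w + 𝟙 (covered w) + 2 * 𝟙 (lookup D w)

      ∑tokens≤ : sum tokens ≤ augmentable + length M₁ + 2 * length M₁ + 2 * ∣ D ∣
      ∑tokens≤ = begin
        sum tokens
          ≡⟨ trans (∑-distrib-+ (λ w → 𝟙 (covered w) * hasFreePartner w + 𝟙 (covered w)) (λ w → 2 * 𝟙 (lookup D w)))
                   (cong₂ _+_ (∑-distrib-+ (λ w → 𝟙 (covered w) * hasFreePartner w) (λ w → 𝟙 (covered w)))
                              (sym (*-distribˡ-sum 2 (λ w → 𝟙 (lookup D w))))) ⟩
        sum (λ w → 𝟙 (covered w) * hasFreePartner w) + sum (λ w → 𝟙 (covered w)) + 2 * sum (λ w → 𝟙 (lookup D w))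
          ≤⟨ +-mono-≤ (+-mono-≤ (sum-covered≤∑ˡ*+∣M₁∣ hasFreePartner (λ w → 𝟙≤1 _)) sum-covered≤2∣M₁∣)
                      (≤-reflexive (cong (2 *_) (sym (∣p∣≡sum D)))) ⟩
        augmentable + length M₁ + 2 * length M₁ + 2 * ∣ D ∣ ∎
        where open ≤-Reasoning

      tokens-D : ∀ w → lookup D w ≡ true → 2 ≤ tokens w
      tokens-D w w∈D rewrite w∈D = m≤n+m 2 _

      tokens-covered : ∀ w → covered w ≡ true → 1 ≤ tokens w
      tokens-covered w cw rewrite cw = ≤-trans (m≤n+m 1 (1 * hasFreePartner w)) (m≤m+n _ (2 * 𝟙 (lookup D w)))

      tokens-freePartner : ∀ w → covered w ≡ true → hasFreePartner w ≡ 1 → 2 ≤ tokens w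
      tokens-freePartner w cw fw rewrite cw | fw = m≤m+n 2 _

      2≤tokens-edge : ∀ {x y} → (x , y) ∈L M* → 2 ≤ tokens x + tokens y
      2≤tokens-edge {x} {y} xy∈M* = by-cover (covered x) (covered y) refl refl
        where
        by-D : ∀ dx dy → lookup D x ≡ dx → lookup D y ≡ dy →
               covered x ≡ false → covered y ≡ false → 2 ≤ tokens x + tokens y
        by-D true _ dx _ _ _ = ≤-trans (tokens-D x dx) (m≤m+n (tokens x) (tokens y))
        by-D false true _ dy _ _ = ≤-trans (tokens-D y dy) (m≤n+m (tokens y) (tokens x))
        by-D false false dx dy cx cy with maximal-off-D x y (proj₁ M*-matching xy∈M*) (lookup≡false⇒∉ dx) (lookup≡false⇒∉ dy)
        ... | inj₁ cx′ with () ← trans (sym cx) cx′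
        ... | inj₂ cy′ with () ← trans (sym cy) cy′

        by-cover : ∀ bx by → covered x ≡ bx → covered y ≡ by → 2 ≤ tokens x + tokens y
        by-cover true true cx cy = +-mono-≤ (tokens-covered x cx) (tokens-covered y cy)
        by-cover true false cx cy =
          ≤-trans (tokens-freePartner x cx (cong 𝟙 (partner-complete _ x M* (inj₁ xy∈M*) (cong not cy))))
                  (m≤m+n (tokens x) (tokens y))
        by-cover false true cx cy =
          ≤-trans (tokens-freePartner y cy (cong 𝟙 (partner-complete _ y M* (inj₂ xy∈M*) (cong not cx))))
                  (m≤n+m (tokens y) (tokens x))
        by-cover false false cx cy = by-D (lookup D x) (lookup D y) refl refl cx cy

      2∣M*∣≤∑tokens : 2 * length M* ≤ sum tokens
      2∣M*∣≤∑tokens = begin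
        2 * length M*                               ≡⟨ cong (2 *_) (sym (∑ˡ-1 M*)) ⟩
        2 * ∑ˡ (λ _ → 1) M*                         ≡⟨ sym (∑ˡ-*ˡ 2 (λ _ → 1) M*) ⟩
        ∑ˡ (λ _ → 2) M*                             ≤⟨ ∑ˡ-mono M* (λ _ → 2≤tokens-edge) ⟩
        ∑ˡ (λ e → tokens (proj₁ e) + tokens (proj₂ e)) M*  ≡⟨ sym (∑ˡ-endpoints tokens M*) ⟩
        ∑ˡ tokens (endpoints M*)                    ≤⟨ ∑ˡ-Unique≤sum tokens (proj₂ M*-matching) ⟩
        sum tokens                                  ∎
        where open ≤-Reasoning

      2∣M*∣≤ : 2 * length M* ≤ augmentable + length M₁ + 2 * length M₁ + 2 * ∣ D ∣
      2∣M*∣≤ = ≤-trans 2∣M*∣≤∑tokens ∑tokens≤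

    -- u′ falls in R and v′ in L; written with xor so that count-bits≢ applies.
    wellPlaced : Vec Bool n → Maybe (Fin n) → Maybe (Fin n) → ℕ
    wellPlaced σ (just u′) (just v′) = 𝟙 ((true xor lookup σ u′) ∧ (false xor lookup σ v′))
    wellPlaced σ _ _ = 0

    good : Vec Bool n → Edge n → ℕ
    good σ (u , v) = wellPlaced σ (freePartner u) (freePartner v)

    freePartners-distinct : ∀ {u v u′ v′} → (u , v) ∈L M₁ →
                            freePartner u ≡ just u′ → freePartner v ≡ just v′ → u′ ≢ v′
    freePartners-distinct uv∈M₁ fu fv refl =
      adj⇒≢ {G = G} (proj₁ M₁-matching uv∈M₁)
        (matching-partner-unique (proj₂ M*-matching) (proj₁ (freePartner-sound _ fu)) (proj₁ (freePartner-sound _ fv)))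

    expected-good-edge : ∀ {u v} → (u , v) ∈L M₁ →
      4 * ∑ˡ (λ σ → good σ (u , v)) (allVecs n) ≡ 2 ^ n * (hasFreePartner u * hasFreePartner v)
    expected-good-edge {u} {v} uv∈M₁ = by-partners (freePartner u) (freePartner v) refl refl
      where
      by-partners : ∀ pu pv → freePartner u ≡ pu → freePartner v ≡ pv →
        4 * ∑ˡ (λ σ → wellPlaced σ pu pv) (allVecs n) ≡ 2 ^ n * (𝟙 (is-just pu) * 𝟙 (is-just pv))
      by-partners (just u′) (just v′) fu fv =
        trans (count-bits≢ n u′ v′ (freePartners-distinct uv∈M₁ fu fv) true false) (sym (*-identityʳ (2 ^ n)))
      by-partners (just _) nothing _ _ = trans (cong (4 *_) (∑ˡ-0 (allVecs n))) (sym (*-zeroʳ (2 ^ n)))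
      by-partners nothing _ _ _ = trans (cong (4 *_) (∑ˡ-0 (allVecs n))) (sym (*-zeroʳ (2 ^ n)))

    expected-good : 4 * ∑ˡ (λ σ → ∑ˡ (good σ) M₁) (allVecs n) ≡ 2 ^ n * augmentable
    expected-good = begin
      4 * ∑ˡ (λ σ → ∑ˡ (good σ) M₁) (allVecs n)      ≡⟨ cong (4 *_) (∑ˡ-comm good (allVecs n) M₁) ⟩
      4 * ∑ˡ (λ e → ∑ˡ (λ σ → good σ e) (allVecs n)) M₁  ≡⟨ sym (∑ˡ-*ˡ 4 _ M₁) ⟩
      ∑ˡ (λ e → 4 * ∑ˡ (λ σ → good σ e) (allVecs n)) M₁  ≡⟨ ∑ˡ-cong M₁ (λ e e∈M₁ → expected-good-edge e∈M₁) ⟩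
      ∑ˡ (λ e → 2 ^ n * (hasFreePartner (proj₁ e) * hasFreePartner (proj₂ e))) M₁  ≡⟨ ∑ˡ-*ˡ (2 ^ n) _ M₁ ⟩
      2 ^ n * augmentable                              ∎
      where open ≡-Reasoning

    module Round (b : ℕ) (σ : Vec Bool n) (M₂ : List (Edge n))
                 (M₂-maximal : IsMaximalBMatching G M₁ b σ M₂) where

      M₂-partner : Fin n → Maybe (Fin n)
      M₂-partner w = partner (λ _ → true) w M₂

      matched₂ : Fin n → ℕ
      matched₂ w = 𝟙 (is-just (M₂-partner w))

      saturated : Fin n → ℕ
      saturated w = 𝟙 (not (covered w) ∧ (b ≤ᵇ deg w M₂))

      freePartnerSaturated : Fin n → ℕ
      freePartnerSaturated w = maybe′ saturated 0 (freePartner w)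

      extend : Maybe (Fin n) → Maybe (Fin n) → Fin n → Fin n → List (Path3 n) → List (Path3 n)
      extend (just u′) (just v′) u v P = (u′ , u , v , v′) ∷ P
      extend _ _ _ _ P = P

      paths : List (Edge n) → List (Path3 n)
      paths [] = []
      paths ((u , v) ∷ M) = extend (M₂-partner u) (M₂-partner v) u v (paths M)

      length-paths : ∀ M → length (paths M) ≡ ∑ˡ (λ e → matched₂ (proj₁ e) * matched₂ (proj₂ e)) M
      length-paths [] = refl
      length-paths ((u , v) ∷ M) with M₂-partner u | M₂-partner v
      ... | just _ | just _ = cong suc (length-paths M)
      ... | just _ | nothing = length-paths M
      ... | nothing | _ = length-paths M

      E₂-edge : ∀ {w z} → (w , z) ∈E M₂ → InE₂ G M₁ σ w z
      E₂-edge (inj₁ wz∈M₂) = proj₁ M₂-maximal wz∈M₂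
      E₂-edge (inj₂ zw∈M₂) with proj₁ M₂-maximal zw∈M₂
      ... | zw-adj , covers , sides = trans (Graph.sym G _ _) zw-adj , swap covers , sides ∘ sym

      E₂-other-end : ∀ {w z} → InE₂ G M₁ σ w z → covered w ≡ true → covered z ≡ false × side M₁ σ w ≢ side M₁ σ z
      E₂-other-end (_ , inj₁ (_ , z-free) , sides) _ = z-free , sides
      E₂-other-end (_ , inj₂ (_ , w-free) , _) w-covered with () ← trans (sym w-covered) w-free

      path-augmenting : ∀ {u v u′ v′} → (u , v) ∈L M₁ → M₂-partner u ≡ just u′ → M₂-partner v ≡ just v′ →
                        IsAug3In M₁ M₂ (u′ , u , v , v′)
      path-augmenting {u} {v} {u′} {v′} uv∈M₁ pu pv =
        inj₁ uv∈M₁ , u′-free , v′-free , u′≢v′ , inj₂ (swap-∈E uu′∈M₂) , inj₂ vv′∈M₂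
        where
        uu′∈M₂ : (u , u′) ∈E M₂
        uu′∈M₂ = proj₁ (partner-sound _ u M₂ pu)
        vv′∈M₂ : (v , v′) ∈E M₂
        vv′∈M₂ = proj₁ (partner-sound _ v M₂ pv)
        u′-free : covered u′ ≡ false
        u′-free = proj₁ (E₂-other-end (E₂-edge uu′∈M₂) (isCovered-fst uv∈M₁))
        v′-free : covered v′ ≡ false
        v′-free = proj₁ (E₂-other-end (E₂-edge vv′∈M₂) (isCovered-snd uv∈M₁))
        u′-in-R : side M₁ σ u′ ≡ false
        u′-in-R = ¬-not (λ u′-in-L → proj₂ (E₂-other-end (E₂-edge uu′∈M₂) (isCovered-fst uv∈M₁))
                                              (trans (side-fst σ uv∈M₁) (sym u′-in-L)))
        v′-in-L : side M₁ σ v′ ≡ true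
        v′-in-L = ¬-not (λ v′-in-R → proj₂ (E₂-other-end (E₂-edge vv′∈M₂) (isCovered-snd uv∈M₁))
                                              (trans (side-snd σ {G = G} M₁-matching uv∈M₁) (sym v′-in-R)))
        u′≢v′ : u′ ≢ v′
        u′≢v′ refl with () ← trans (sym u′-in-R) v′-in-L

      paths-augmenting : ∀ M → (∀ {e} → e ∈L M → e ∈L M₁) → ∀ {p} → p ∈L paths M → IsAug3In M₁ M₂ p
      paths-augmenting ((u , v) ∷ M) M⊆M₁ p∈ with M₂-partner u in pu | M₂-partner v in pv
      paths-augmenting ((u , v) ∷ M) M⊆M₁ (here refl) | just _ | just _ = path-augmenting (M⊆M₁ (here refl)) pu pv
      paths-augmenting ((u , v) ∷ M) M⊆M₁ (there p∈) | just _ | just _ = paths-augmenting M (M⊆M₁ ∘ there) p∈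
      paths-augmenting ((u , v) ∷ M) M⊆M₁ p∈ | just _ | nothing = paths-augmenting M (M⊆M₁ ∘ there) p∈
      paths-augmenting ((u , v) ∷ M) M⊆M₁ p∈ | nothing | _ = paths-augmenting M (M⊆M₁ ∘ there) p∈

      paths-middle : ∀ M {u′ u v v′} → (u′ , u , v , v′) ∈L paths M → u ∈L endpoints M × v ∈L endpoints M
      paths-middle ((u , v) ∷ M) p∈ with M₂-partner u | M₂-partner v
      paths-middle ((u , v) ∷ M) (here refl) | just _ | just _ = here refl , there (here refl)
      paths-middle ((u , v) ∷ M) (there p∈) | just _ | just _ = map (there ∘ there) (there ∘ there) (paths-middle M p∈)
      paths-middle ((u , v) ∷ M) p∈ | just _ | nothing = map (there ∘ there) (there ∘ there) (paths-middle M p∈)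
      paths-middle ((u , v) ∷ M) p∈ | nothing | _ = map (there ∘ there) (there ∘ there) (paths-middle M p∈)

      paths-disjoint : ∀ M → Unique (endpoints M) → AllPairs DisjointMid (paths M)
      paths-disjoint [] _ = []
      paths-disjoint ((u , v) ∷ M) (u∉ ∷ v∉ ∷ unique) with M₂-partner u | M₂-partner v
      ... | just u′ | just v′ = All.tabulate disjoint ∷ paths-disjoint M unique
        where
        disjoint : ∀ {q} → q ∈L paths M → DisjointMid (u′ , u , v , v′) q
        disjoint q∈ with paths-middle M q∈
        ... | x∈ , y∈ = All.lookup u∉ (there x∈) , All.lookup u∉ (there y∈) , All.lookup v∉ x∈ , All.lookup v∉ y∈
      ... | just _ | nothing = paths-disjoint M unique
      ... | nothing | _ = paths-disjoint M unique

      paths-family : IsAugFamily M₁ M₂ (paths M₁)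
      paths-family = paths-augmenting M₁ (λ e∈ → e∈) , paths-disjoint M₁ (proj₂ M₁-matching)

      b*saturated≤free-degree : ∀ w → b * saturated w ≤ 𝟙 (not (covered w)) * deg w M₂
      b*saturated≤free-degree w with covered w | b ≤ᵇ deg w M₂ in b≤deg
      ... | true | _ = ≤-reflexive (*-zeroʳ b)
      ... | false | false = ≤-trans (≤-reflexive (*-zeroʳ b)) z≤n
      ... | false | true = ≤-trans (≤-reflexive (*-identityʳ b))
                                   (≤-trans (≤ᵇ⇒≤ b (deg w M₂) (subst T (sym b≤deg) _)) (≤-reflexive (sym (*-identityˡ _))))

      free-degree≤covered-degree : sum (λ w → 𝟙 (not (covered w)) * deg w M₂) ≤ sum (λ w → 𝟙 (covered w) * deg w M₂)
      free-degree≤covered-degree = begin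
        sum (λ w → 𝟙 (not (covered w)) * deg w M₂)                   ≡⟨ sum-*-deg (λ w → 𝟙 (not (covered w))) M₂ ⟩
        ∑ˡ (λ e → sum (λ w → 𝟙 (not (covered w)) * incident w e)) M₂ ≤⟨ ∑ˡ-mono M₂ (λ e e∈ → ≤-trans (free≤1 e∈) (1≤covered e∈)) ⟩
        ∑ˡ (λ e → sum (λ w → 𝟙 (covered w) * incident w e)) M₂       ≡⟨ sym (sum-*-deg (λ w → 𝟙 (covered w)) M₂) ⟩
        sum (λ w → 𝟙 (covered w) * deg w M₂)                         ∎
        where
        open ≤-Reasoning
        one-free-end : ∀ {x y} → InE₂ G M₁ σ x y → 𝟙 (not (covered x)) + 𝟙 (not (covered y)) ≡ 1
        one-free-end (_ , inj₁ (cx , cy) , _) rewrite cx | cy = refl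
        one-free-end (_ , inj₂ (cy , cx) , _) rewrite cx | cy = refl
        free≤1 : ∀ {x y} → (x , y) ∈L M₂ → sum (λ w → 𝟙 (not (covered w)) * incident w (x , y)) ≤ 1
        free≤1 {x} {y} xy∈M₂ = ≤-trans (sum-incident≤ (λ w → 𝟙 (not (covered w))) x y)
                                       (≤-reflexive (one-free-end (proj₁ M₂-maximal xy∈M₂)))
        1≤covered : ∀ {x y} → (x , y) ∈L M₂ → 1 ≤ sum (λ w → 𝟙 (covered w) * incident w (x , y))
        1≤covered {x} {y} xy∈M₂ with proj₁ M₂-maximal xy∈M₂
        ... | _ , inj₁ (cx , _) , _ = subst (λ c → 𝟙 c ≤ sum (λ w → 𝟙 (covered w) * incident w (x , y))) cx (≤-sum-incident (λ w → 𝟙 (covered w)) (x , y) (inj₁ refl))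
        ... | _ , inj₂ (cy , _) , _ = subst (λ c → 𝟙 c ≤ sum (λ w → 𝟙 (covered w) * incident w (x , y))) cy (≤-sum-incident (λ w → 𝟙 (covered w)) (x , y) (inj₂ refl))

      covered-degree≤matched₂ : ∀ w → 𝟙 (covered w) * deg w M₂ ≤ 𝟙 (covered w) * matched₂ w
      covered-degree≤matched₂ w with covered w in cw | M₂-partner w in pw
      ... | false | _ = z≤n
      ... | true | just _ = *-monoʳ-≤ 1 (subst (deg w M₂ ≤_) (cong (if_then 1 else b) cw) (proj₁ (proj₂ M₂-maximal) w))
      ... | true | nothing = ≤-reflexive (cong (1 *_) (no-partner⇒deg≡0 w M₂ pw))

      b*∑saturated≤ : b * sum saturated ≤ ∑ˡ (λ e → matched₂ (proj₁ e) * matched₂ (proj₂ e)) M₁ + length M₁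
      b*∑saturated≤ = begin
        b * sum saturated                               ≡⟨ *-distribˡ-sum b saturated ⟩
        sum (λ w → b * saturated w)                     ≤⟨ sum-mono b*saturated≤free-degree ⟩
        sum (λ w → 𝟙 (not (covered w)) * deg w M₂)      ≤⟨ free-degree≤covered-degree ⟩
        sum (λ w → 𝟙 (covered w) * deg w M₂)            ≤⟨ sum-mono covered-degree≤matched₂ ⟩
        sum (λ w → 𝟙 (covered w) * matched₂ w)          ≤⟨ sum-covered≤∑ˡ*+∣M₁∣ matched₂ (λ w → 𝟙≤1 _) ⟩
        ∑ˡ (λ e → matched₂ (proj₁ e) * matched₂ (proj₂ e)) M₁ + length M₁ ∎
        where open ≤-Reasoning

      freePartner-E₂ : ∀ {w z} → covered w ≡ true → freePartner w ≡ just z → side M₁ σ w ≢ lookup σ z →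
                       InE₂ G M₁ σ w z
      freePartner-E₂ {w} cw fw sides with freePartner-sound w fw
      ... | wz∈M* , z-free = adj-∈E {G = G} M*-matching wz∈M* , inj₁ (cw , z-free) , λ eq → sides (trans eq (side-free {M₁ = M₁} σ z-free))

      saturated-if : ∀ {z} → covered z ≡ false → b ≤ deg z M₂ → saturated z ≡ 1
      saturated-if {z} z-free b≤deg rewrite z-free = cong 𝟙 (Equivalence.to T-≡ (≤⇒≤ᵇ {b} {deg z M₂} b≤deg))

      unmatched-E₂-neighbour-saturated : ∀ {w z} → InE₂ G M₁ σ w z → covered w ≡ true →
                                         M₂-partner w ≡ nothing → saturated z ≡ 1
      unmatched-E₂-neighbour-saturated {w} {z} wz∈E₂ cw unmatched with proj₂ (proj₂ M₂-maximal) w z wz∈E₂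
      ... | inj₁ w-over = contradiction w-over
            (subst₂ (λ c d → ¬ c < suc d) (sym (cong (if_then 1 else b) cw)) (sym (no-partner⇒deg≡0 w M₂ unmatched))
                    (<-irrefl refl))
      ... | inj₂ z-over = saturated-if {z} z-free (subst (_≤ deg z M₂) (cong (if_then 1 else b) z-free) (≤-pred z-over))
        where
        z-free : covered z ≡ false
        z-free = proj₁ (E₂-other-end wz∈E₂ cw)

      good≤ : ∀ {u v} → (u , v) ∈L M₁ →
              good σ (u , v) ≤ matched₂ u * matched₂ v + freePartnerSaturated u + freePartnerSaturated v
      good≤ {u} {v} uv∈M₁ = by-free-partners (freePartner u) (freePartner v) refl refl
        where
        bound : ℕ
        bound = matched₂ u * matched₂ v + freePartnerSaturated u + freePartnerSaturated v

        saturated-partner : ∀ {w w′} → covered w ≡ true → freePartner w ≡ just w′ →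
                            side M₁ σ w ≢ lookup σ w′ → M₂-partner w ≡ nothing → freePartnerSaturated w ≡ 1
        saturated-partner cw fw sides unmatched =
          trans (cong (maybe′ saturated 0) fw) (unmatched-E₂-neighbour-saturated (freePartner-E₂ cw fw sides) cw unmatched)

        by-M₂-partners : ∀ {u′ v′} → freePartner u ≡ just u′ → freePartner v ≡ just v′ →
                         lookup σ u′ ≡ false → lookup σ v′ ≡ true → ∀ pu pv → M₂-partner u ≡ pu → M₂-partner v ≡ pv →
                         1 ≤ bound
        by-M₂-partners _ _ _ _ (just _) (just _) mu mv =
          ≤-trans (≤-reflexive (sym (cong₂ (λ p q → 𝟙 (is-just p) * 𝟙 (is-just q)) mu mv)))
                  (≤-trans (m≤m+n _ (freePartnerSaturated u)) (m≤m+n _ (freePartnerSaturated v)))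
        by-M₂-partners fu _ σu′ _ nothing _ mu _ =
          ≤-trans (≤-reflexive (sym (saturated-partner (isCovered-fst uv∈M₁) fu
                                       (λ eq → case trans (sym (side-fst σ uv∈M₁)) (trans eq σu′) of λ ()) mu)))
                  (≤-trans (m≤n+m (freePartnerSaturated u) (matched₂ u * matched₂ v)) (m≤m+n _ (freePartnerSaturated v)))
        by-M₂-partners _ fv _ σv′ (just _) nothing _ mv =
          ≤-trans (≤-reflexive (sym (saturated-partner (isCovered-snd uv∈M₁) fv
                                       (λ eq → case trans (sym (side-snd σ {G = G} M₁-matching uv∈M₁)) (trans eq σv′) of λ ()) mv)))
                  (m≤n+m (freePartnerSaturated v) _)

        by-free-partners : ∀ pu pv → freePartner u ≡ pu → freePartner v ≡ pv → wellPlaced σ pu pv ≤ bound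
        by-free-partners (just u′) (just v′) fu fv with lookup σ u′ in σu′ | lookup σ v′ in σv′
        ... | false | true = by-M₂-partners fu fv σu′ σv′ (M₂-partner u) (M₂-partner v) refl refl
        ... | false | false = z≤n
        ... | true | _ = z≤n
        by-free-partners (just _) nothing _ _ = z≤n
        by-free-partners nothing _ _ _ = z≤n

      saturatedAcross : Fin n → Edge n → ℕ
      saturatedAcross w (x , y) = δ x w * saturated y + δ y w * saturated x

      freePartnerSaturated≤ : ∀ w → freePartnerSaturated w ≤ ∑ˡ (saturatedAcross w) M*
      freePartnerSaturated≤ w with freePartner w in fw
      ... | nothing = z≤n
      ... | just z with proj₁ (freePartner-sound w fw)
      ...   | inj₁ wz∈M* = ≤-trans (≤-trans (≤-reflexive (sym (δ-refl-* w (saturated z)))) (m≤m+n _ _))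
                               (≤-∑ˡ (saturatedAcross w) M* wz∈M*)
      ...   | inj₂ zw∈M* = ≤-trans (≤-trans (≤-reflexive (sym (δ-refl-* w (saturated z)))) (m≤n+m _ _))
                               (≤-∑ˡ (saturatedAcross w) M* zw∈M*)

      ∑freePartnerSaturated≤ : ∑ˡ (λ e → freePartnerSaturated (proj₁ e) + freePartnerSaturated (proj₂ e)) M₁ ≤ sum saturated
      ∑freePartnerSaturated≤ = begin
        ∑ˡ (λ e → freePartnerSaturated (proj₁ e) + freePartnerSaturated (proj₂ e)) M₁
          ≡⟨ sym (∑ˡ-endpoints freePartnerSaturated M₁) ⟩
        ∑ˡ freePartnerSaturated (endpoints M₁)              ≤⟨ ∑ˡ-Unique≤sum freePartnerSaturated (proj₂ M₁-matching) ⟩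
        sum freePartnerSaturated                            ≤⟨ sum-mono freePartnerSaturated≤ ⟩
        sum (λ w → ∑ˡ (saturatedAcross w) M*)               ≡⟨ sum-∑ˡ-comm saturatedAcross M* ⟩
        ∑ˡ (λ e → sum (λ w → saturatedAcross w e)) M*       ≡⟨ ∑ˡ-cong M* (λ e _ → sum-saturatedAcross e) ⟩
        ∑ˡ (λ e → saturated (proj₁ e) + saturated (proj₂ e)) M*  ≡⟨ sym (∑ˡ-endpoints saturated M*) ⟩
        ∑ˡ saturated (endpoints M*)                         ≤⟨ ∑ˡ-Unique≤sum saturated (proj₂ M*-matching) ⟩
        sum saturated                                       ∎
        where
        open ≤-Reasoning
        sum-saturatedAcross : ∀ e → sum (λ w → saturatedAcross w e) ≡ saturated (proj₁ e) + saturated (proj₂ e)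
        sum-saturatedAcross (x , y) =
          trans (∑-distrib-+ (λ w → δ x w * saturated y) (λ w → δ y w * saturated x))
                (trans (cong₂ _+_ (sum-δ x (λ _ → saturated y)) (sum-δ y (λ _ → saturated x))) (+-comm (saturated y) (saturated x)))

      ∑good≤ : ∑ˡ (good σ) M₁ ≤ length (paths M₁) + sum saturated
      ∑good≤ = begin
        ∑ˡ (good σ) M₁
          ≤⟨ ∑ˡ-mono M₁ (λ e → good≤) ⟩
        ∑ˡ (λ e → matched₂ (proj₁ e) * matched₂ (proj₂ e) + freePartnerSaturated (proj₁ e) + freePartnerSaturated (proj₂ e)) M₁
          ≡⟨ ∑ˡ-cong M₁ (λ e _ → +-assoc (matched₂ (proj₁ e) * matched₂ (proj₂ e)) _ _) ⟩
        ∑ˡ (λ e → matched₂ (proj₁ e) * matched₂ (proj₂ e) + (freePartnerSaturated (proj₁ e) + freePartnerSaturated (proj₂ e))) M₁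
          ≡⟨ ∑ˡ-+ _ _ M₁ ⟩
        ∑ˡ (λ e → matched₂ (proj₁ e) * matched₂ (proj₂ e)) M₁ + ∑ˡ (λ e → freePartnerSaturated (proj₁ e) + freePartnerSaturated (proj₂ e)) M₁
          ≤⟨ +-mono-≤ (≤-reflexive (sym (length-paths M₁))) ∑freePartnerSaturated≤ ⟩
        length (paths M₁) + sum saturated ∎
        where open ≤-Reasoning

      b*∑good≤ : b * ∑ˡ (good σ) M₁ ≤ suc b * length (paths M₁) + length M₁
      b*∑good≤ = begin
        b * ∑ˡ (good σ) M₁                        ≤⟨ *-monoʳ-≤ b ∑good≤ ⟩
        b * (P + sum saturated)                   ≡⟨ *-distribˡ-+ b P (sum saturated) ⟩
        b * P + b * sum saturated                 ≤⟨ +-monoʳ-≤ (b * P) b*∑saturated≤ ⟩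
        b * P + (∑ˡ (λ e → matched₂ (proj₁ e) * matched₂ (proj₂ e)) M₁ + length M₁)
          ≡⟨ cong (λ k → b * P + (k + length M₁)) (sym (length-paths M₁)) ⟩
        b * P + (P + length M₁)                   ≡⟨ sym (+-assoc (b * P) P (length M₁)) ⟩
        b * P + P + length M₁                     ≡⟨ cong (_+ length M₁) (+-comm (b * P) P) ⟩
        suc b * P + length M₁                     ∎
        where
        open ≤-Reasoning
        P : ℕ
        P = length (paths M₁)

    module Rounds (b : ℕ) (M₂ : Vec Bool n → List (Edge n))
                  (M₂-maximal : ∀ σ → IsMaximalBMatching G M₁ b σ (M₂ σ)) where

      paths : Vec Bool n → List (Path3 n)
      paths σ = Round.paths b σ (M₂ σ) (M₂-maximal σ) M₁

      b*∑∑good≤ : b * ∑ˡ (λ σ → ∑ˡ (good σ) M₁) (allVecs n) ≤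
                  suc b * ∑ˡ (λ σ → length (paths σ)) (allVecs n) + length M₁ * 2 ^ n
      b*∑∑good≤ = begin
        b * ∑ˡ (λ σ → ∑ˡ (good σ) M₁) (allVecs n)                    ≡⟨ sym (∑ˡ-*ˡ b _ (allVecs n)) ⟩
        ∑ˡ (λ σ → b * ∑ˡ (good σ) M₁) (allVecs n)                    ≤⟨ ∑ˡ-mono (allVecs n) (λ σ _ → Round.b*∑good≤ b σ (M₂ σ) (M₂-maximal σ)) ⟩
        ∑ˡ (λ σ → suc b * length (paths σ) + length M₁) (allVecs n)  ≡⟨ ∑ˡ-+ _ (λ _ → length M₁) (allVecs n) ⟩
        ∑ˡ (λ σ → suc b * length (paths σ)) (allVecs n) + ∑ˡ (λ _ → length M₁) (allVecs n)
          ≡⟨ cong₂ _+_ (∑ˡ-*ˡ (suc b) _ (allVecs n)) ∑ˡ-∣M₁∣ ⟩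
        suc b * ∑ˡ (λ σ → length (paths σ)) (allVecs n) + length M₁ * 2 ^ n ∎
        where
        open ≤-Reasoning
        ∑ˡ-∣M₁∣ : ∑ˡ (λ _ → length M₁) (allVecs n) ≡ length M₁ * 2 ^ n
        ∑ˡ-∣M₁∣ = begin-equality
          ∑ˡ (λ _ → length M₁) (allVecs n)      ≡⟨ ∑ˡ-cong (allVecs n) (λ _ _ → sym (*-identityʳ (length M₁))) ⟩
          ∑ˡ (λ _ → length M₁ * 1) (allVecs n)  ≡⟨ ∑ˡ-*ˡ (length M₁) (λ _ → 1) (allVecs n) ⟩
          length M₁ * ∑ˡ (λ _ → 1) (allVecs n)  ≡⟨ cong (length M₁ *_) (∑ˡ-1-allVecs n) ⟩
          length M₁ * 2 ^ n                     ∎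

module Counting where

  open import Data.Nat
  open import Data.Nat.Properties
  open import Data.Nat.Solver using (module +-*-Solver)
  open +-*-Solver
  open import Relation.Binary.PropositionalEquality

  counting-inequality : ∀ b μ A K S m d N →
    2 * μ ≤ A + m + 2 * m + 2 * d → 4 * K ≡ N * A → b * K ≤ suc b * S + m * N →
    2 * b * μ * N ≤ 4 * (b + 1) * S + (4 * m + 2 * b * d + 3 * b * m) * N
  counting-inequality b μ A K S m d N 2μ≤ 4K≡NA bK≤ = begin
    2 * b * μ * N                           ≡⟨ solve 3 (λ b μ N → con 2 :* b :* μ :* N := b :* N :* (con 2 :* μ)) refl b μ N ⟩
    b * N * (2 * μ)                         ≤⟨ *-monoʳ-≤ (b * N) 2μ≤ ⟩
    b * N * (A + m + 2 * m + 2 * d)         ≡⟨ solve 5 (λ b N A m d → b :* N :* (A :+ m :+ con 2 :* m :+ con 2 :* d)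
                                                        := b :* (N :* A) :+ b :* N :* (con 3 :* m :+ con 2 :* d)) refl b N A m d ⟩
    b * (N * A) + b * N * (3 * m + 2 * d)   ≡⟨ cong (λ k → b * k + b * N * (3 * m + 2 * d)) (sym 4K≡NA) ⟩
    b * (4 * K) + b * N * (3 * m + 2 * d)   ≡⟨ cong (_+ b * N * (3 * m + 2 * d)) (solve 2 (λ b K → b :* (con 4 :* K) := con 4 :* (b :* K)) refl b K) ⟩
    4 * (b * K) + b * N * (3 * m + 2 * d)   ≤⟨ +-monoˡ-≤ (b * N * (3 * m + 2 * d)) (*-monoʳ-≤ 4 bK≤) ⟩
    4 * (suc b * S + m * N) + b * N * (3 * m + 2 * d)
      ≡⟨ solve 5 (λ b S m N d → con 4 :* ((con 1 :+ b) :* S :+ m :* N) :+ b :* N :* (con 3 :* m :+ con 2 :* d)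
                                := con 4 :* (b :+ con 1) :* S :+ (con 4 :* m :+ con 2 :* b :* d :+ con 3 :* b :* m) :* N) refl b S m N d ⟩
    4 * (b + 1) * S + (4 * m + 2 * b * d + 3 * b * m) * N ∎
    where open ≤-Reasoning

module Rationals where

  open import Defs using (ℕtoℚ; sumℚ; powℚ; Expect; allVecs)
  open import Data.Bool using (Bool)
  open import Data.Vec using (Vec)
  open import Function using (_$_)
  open Sums using (∑ˡ)
  import Data.Nat.Coprimality as Coprime
  open import Data.Nat as ℕ using (ℕ; zero; suc)
  import Data.Nat.Properties as ℕ
  open import Data.Integer as ℤ using (+_)
  import Data.Integer.Properties as ℤ
  open import Data.Rational
  open import Data.Rational.Properties
  import Data.Rational.Unnormalised as ℚᵘ
  import Data.Rational.Unnormalised.Properties as ℚᵘ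
  open import Data.Rational.Solver using (module +-*-Solver)
  open +-*-Solver
  open import Data.List using ([]; _∷_; map)
  open import Relation.Binary.PropositionalEquality

  ℕtoℚ≡mkℚ : ∀ k → ℕtoℚ k ≡ mkℚ (+ k) 0 (Coprime.sym (Coprime.1-coprimeTo k))
  ℕtoℚ≡mkℚ k = normalize-coprime _

  ℕtoℚ-+ : ∀ a b → ℕtoℚ (a ℕ.+ b) ≡ ℕtoℚ a + ℕtoℚ b
  ℕtoℚ-+ a b = trans (/-cong {p₁ = + (a ℕ.+ b)} {q₁ = 1} {p₂ = + a ℤ.* + 1 ℤ.+ + b ℤ.* + 1} {q₂ = 1}
                             (cong₂ ℤ._+_ (sym (ℤ.*-identityʳ (+ a))) (sym (ℤ.*-identityʳ (+ b)))) refl)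
                     (cong₂ _+_ (sym (ℕtoℚ≡mkℚ a)) (sym (ℕtoℚ≡mkℚ b)))

  ℕtoℚ-* : ∀ a b → ℕtoℚ (a ℕ.* b) ≡ ℕtoℚ a * ℕtoℚ b
  ℕtoℚ-* a b = trans (/-cong {p₁ = + (a ℕ.* b)} {q₁ = 1} {p₂ = + a ℤ.* + b} {q₂ = 1} (ℤ.pos-* a b) refl)
                     (cong₂ _*_ (sym (ℕtoℚ≡mkℚ a)) (sym (ℕtoℚ≡mkℚ b)))

  ℕtoℚ-mono-≤ : ∀ {a b} → a ℕ.≤ b → ℕtoℚ a ≤ ℕtoℚ b
  ℕtoℚ-mono-≤ {a} {b} a≤b rewrite ℕtoℚ≡mkℚ a | ℕtoℚ≡mkℚ b =
    *≤* (subst₂ ℤ._≤_ (sym (ℤ.*-identityʳ (+ a))) (sym (ℤ.*-identityʳ (+ b))) (ℤ.+≤+ a≤b))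

  ℕtoℚ-nonNeg : ∀ a → 0ℚ ≤ ℕtoℚ a
  ℕtoℚ-nonNeg a = ℕtoℚ-mono-≤ {0} {a} ℕ.z≤n

  a/d*d≡a : ∀ a d → (+ a / suc d) * ℕtoℚ (suc d) ≡ ℕtoℚ a
  a/d*d≡a a d = toℚᵘ-injective (begin
    toℚᵘ ((+ a / suc d) * ℕtoℚ (suc d))             ≈⟨ toℚᵘ-homo-* (+ a / suc d) (ℕtoℚ (suc d)) ⟩
    toℚᵘ (+ a / suc d) ℚᵘ.* toℚᵘ (ℕtoℚ (suc d))     ≈⟨ ℚᵘ.*-cong (toℚᵘ-fromℚᵘ (ℚᵘ.mkℚᵘ (+ a) d)) (toℚᵘ-cong (ℕtoℚ≡mkℚ (suc d))) ⟩
    ℚᵘ.mkℚᵘ (+ a) d ℚᵘ.* ℚᵘ.mkℚᵘ (+ suc d) 0        ≈⟨ ℚᵘ.*≡* cross ⟩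
    ℚᵘ.mkℚᵘ (+ a) 0                                  ≈⟨ ℚᵘ.≃-sym (toℚᵘ-cong (ℕtoℚ≡mkℚ a)) ⟩
    toℚᵘ (ℕtoℚ a)                                    ∎)
    where
    open ℚᵘ.≃-Reasoning
    cross : (+ a ℤ.* + suc d) ℤ.* + 1 ≡ + a ℤ.* + (suc d ℕ.* 1)
    cross = trans (ℤ.*-identityʳ _) (cong (λ k → + a ℤ.* + k) (sym (ℕ.*-identityʳ (suc d))))

  1/b*b≡1 : ∀ b .{{_ : ℕ.NonZero b}} → (+ 1 / b) * ℕtoℚ b ≡ 1ℚ
  1/b*b≡1 (suc b) = a/d*d≡a 1 b

  sumℚ-ℕtoℚ : ∀ {A : Set} (f : A → ℕ) xs → sumℚ (map (λ x → ℕtoℚ (f x)) xs) ≡ ℕtoℚ (∑ˡ f xs)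
  sumℚ-ℕtoℚ f [] = refl
  sumℚ-ℕtoℚ f (x ∷ xs) = trans (cong (λ q → ℕtoℚ (f x) + q) (sumℚ-ℕtoℚ f xs)) (sym (ℕtoℚ-+ (f x) (∑ˡ f xs)))

  ½^n*2^n≡1 : ∀ n → powℚ ½ n * ℕtoℚ (2 ℕ.^ n) ≡ 1ℚ
  ½^n*2^n≡1 zero = refl
  ½^n*2^n≡1 (suc n) = begin
    ½ * powℚ ½ n * ℕtoℚ (2 ℕ.* 2 ℕ.^ n)       ≡⟨ cong (½ * powℚ ½ n *_) (ℕtoℚ-* 2 (2 ℕ.^ n)) ⟩
    ½ * powℚ ½ n * (ℕtoℚ 2 * ℕtoℚ (2 ℕ.^ n))  ≡⟨ solve 2 (λ p t → con ½ :* p :* (con (ℕtoℚ 2) :* t) := (con ½ :* con (ℕtoℚ 2)) :* (p :* t))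
                                                       refl (powℚ ½ n) (ℕtoℚ (2 ℕ.^ n)) ⟩
    (½ * ℕtoℚ 2) * (powℚ ½ n * ℕtoℚ (2 ℕ.^ n)) ≡⟨ cong ((½ * ℕtoℚ 2) *_) (½^n*2^n≡1 n) ⟩
    1ℚ                                          ∎
    where open ≡-Reasoning

  ½^n-nonNeg : ∀ n → 0ℚ ≤ powℚ ½ n
  ½^n-nonNeg zero = *≤* (ℤ.+≤+ ℕ.z≤n)
  ½^n-nonNeg (suc n) = subst (_≤ ½ * powℚ ½ n) (*-zeroʳ ½) (*-monoˡ-≤-nonNeg ½ (½^n-nonNeg n))

  0≤p-q⇒q≤p : ∀ {p q} → 0ℚ ≤ p - q → q ≤ p
  0≤p-q⇒q≤p {p} {q} 0≤p-q = subst₂ _≤_ (+-identityʳ q) (solve 2 (λ p q → q :+ (p :- q) := p) refl p q) (+-monoʳ-≤ q 0≤p-q)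

  q≤p⇒0≤p-q : ∀ {p q} → q ≤ p → 0ℚ ≤ p - q
  q≤p⇒0≤p-q {p} {q} q≤p = subst (_≤ p - q) (+-inverseʳ q) (+-monoˡ-≤ (- q) q≤p)

  0≤* : ∀ {p q} → 0ℚ ≤ p → 0ℚ ≤ q → 0ℚ ≤ p * q
  0≤* {p} {q} 0≤p 0≤q = subst (_≤ p * q) (*-zeroʳ p) (*-monoˡ-≤-nonNeg p {{nonNegative 0≤p}} 0≤q)

  p≡q⇒p-q≡0 : ∀ {p q} → p ≡ q → p - q ≡ 0ℚ
  p≡q⇒p-q≡0 {p} refl = +-inverseʳ p

  -- After multiplying by 4(b+1), the difference of the two sides is a sum of
  -- manifestly nonnegative terms plus a combination of the four defining
  -- equations, each written as  lhs - rhs = 0.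
  expectation-bound : ∀ (β b⁻¹ c ε b μ m d S N h : ℚ) →
    β * (b + 1ℚ) ≡ b → b⁻¹ * b ≡ 1ℚ → (½ + c) * μ ≡ m → h * N ≡ 1ℚ →
    0ℚ ≤ b → 0ℚ ≤ μ → 0ℚ ≤ ε → 0ℚ ≤ h →
    d ≤ ε * (+ 1 / 4) * μ →
    (+ 2 / 1) * b * μ * N ≤ (+ 4 / 1) * (b + 1ℚ) * S + ((+ 4 / 1) * m + (+ 2 / 1) * b * d + (+ 3 / 1) * b * m) * N →
    β * (((+ 1 / 4) * (½ - (+ 3 / 1) * c)) - (b⁻¹ * (½ + c)) - ((+ 7 / 8) * ε)) * μ ≤ h * S
  expectation-bound β b⁻¹ c ε b μ m d S N h β≡ b⁻¹≡ m≡ h≡ 0≤b 0≤μ 0≤ε 0≤h d≤ counting =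
    *-cancelˡ-≤-pos r {{r-pos}} (0≤p-q⇒q≤p (subst (0ℚ ≤_) (sym difference≡) slack-nonNeg))
    where
    2ℚ 3ℚ 4ℚ ¼ ⅞ r Y X slack : ℚ
    2ℚ = + 2 / 1
    3ℚ = + 3 / 1
    4ℚ = + 4 / 1
    ¼ = + 1 / 4
    ⅞ = + 7 / 8
    r = 4ℚ * (b + 1ℚ)
    r-pos : Positive r
    r-pos = positive (subst (_< r) (*-zeroʳ 4ℚ)
                        (*-monoʳ-<-pos 4ℚ {{_}} (subst (_< b + 1ℚ) (+-identityʳ 0ℚ) (+-mono-≤-< {0ℚ} {b} {0ℚ} {1ℚ} 0≤b (*<* (ℤ.+<+ (ℕ.s≤s ℕ.z≤n)))))))
    Y = (¼ * (½ - 3ℚ * c)) - (b⁻¹ * (½ + c)) - (⅞ * ε)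
    X = 4ℚ * m + 2ℚ * b * d + 3ℚ * b * m
    W : ℚ → ℚ → ℚ → ℚ → ℚ
    W z₁ z₂ z₃ z₄ = (0ℚ - 4ℚ * Y * μ) * z₁ + 4ℚ * (½ + c) * μ * z₂ + (4ℚ + 3ℚ * b) * z₃ - (X - 2ℚ * b * μ) * z₄
    slack = h * ((4ℚ * (b + 1ℚ) * S + X * N) - 2ℚ * b * μ * N) + (2ℚ * b) * (ε * ¼ * μ - d) + 3ℚ * b * ε * μ
    identity : r * (h * S) - r * (β * Y * μ) ≡ slack + W (β * (b + 1ℚ) - b) (b⁻¹ * b - 1ℚ) ((½ + c) * μ - m) (h * N - 1ℚ)
    identity = solve 11 (λ β b⁻¹ c ε b μ m d S N h →
       let Y = (con ¼ :* (con ½ :- con 3ℚ :* c)) :- (b⁻¹ :* (con ½ :+ c)) :- (con ⅞ :* ε)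
           X = con 4ℚ :* m :+ con 2ℚ :* b :* d :+ con 3ℚ :* b :* m
           r = con 4ℚ :* (b :+ con 1ℚ)
       in r :* (h :* S) :- r :* (β :* Y :* μ) :=
          (h :* ((con 4ℚ :* (b :+ con 1ℚ) :* S :+ X :* N) :- con 2ℚ :* b :* μ :* N)
             :+ (con 2ℚ :* b) :* (ε :* con ¼ :* μ :- d) :+ con 3ℚ :* b :* ε :* μ)
          :+ ((con 0ℚ :- con 4ℚ :* Y :* μ) :* (β :* (b :+ con 1ℚ) :- b) :+ con 4ℚ :* (con ½ :+ c) :* μ :* (b⁻¹ :* b :- con 1ℚ)
              :+ (con 4ℚ :+ con 3ℚ :* b) :* ((con ½ :+ c) :* μ :- m) :- (X :- con 2ℚ :* b :* μ) :* (h :* N :- con 1ℚ)))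
       refl β b⁻¹ c ε b μ m d S N h
    W-0 : W 0ℚ 0ℚ 0ℚ 0ℚ ≡ 0ℚ
    W-0 = solve 4 (λ p q r s → (con 0ℚ :- p) :* con 0ℚ :+ q :* con 0ℚ :+ r :* con 0ℚ :- s :* con 0ℚ := con 0ℚ)
                refl (4ℚ * Y * μ) (4ℚ * (½ + c) * μ) (4ℚ + 3ℚ * b) (X - 2ℚ * b * μ)
    difference≡ : r * (h * S) - r * (β * Y * μ) ≡ slack
    difference≡ = begin
      r * (h * S) - r * (β * Y * μ)   ≡⟨ identity ⟩
      slack + W (β * (b + 1ℚ) - b) (b⁻¹ * b - 1ℚ) ((½ + c) * μ - m) (h * N - 1ℚ)
        ≡⟨ cong (λ q → slack + q) (trans (cong₂ (λ z₁ z₂ → W z₁ z₂ ((½ + c) * μ - m) (h * N - 1ℚ)) (p≡q⇒p-q≡0 β≡) (p≡q⇒p-q≡0 b⁻¹≡))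
                                   (cong₂ (W 0ℚ 0ℚ) (p≡q⇒p-q≡0 m≡) (p≡q⇒p-q≡0 h≡))) ⟩
      slack + W 0ℚ 0ℚ 0ℚ 0ℚ           ≡⟨ trans (cong (λ q → slack + q) W-0) (+-identityʳ slack) ⟩
      slack                           ∎
      where open ≡-Reasoning
    slack-nonNeg : 0ℚ ≤ slack
    slack-nonNeg =
      +-mono-≤ (+-mono-≤ (0≤* 0≤h (q≤p⇒0≤p-q counting)) (0≤* (0≤* 0≤2 0≤b) (q≤p⇒0≤p-q d≤)))
               (0≤* (0≤* (0≤* 0≤3 0≤b) 0≤ε) 0≤μ)
      where
      0≤2 : 0ℚ ≤ 2ℚ
      0≤2 = *≤* (ℤ.+≤+ ℕ.z≤n)
      0≤3 : 0ℚ ≤ 3ℚ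
      0≤3 = *≤* (ℤ.+≤+ ℕ.z≤n)

  ℕtoℚ-*³ : ∀ x y z → ℕtoℚ (x ℕ.* y ℕ.* z) ≡ ℕtoℚ x * ℕtoℚ y * ℕtoℚ z
  ℕtoℚ-*³ x y z = trans (ℕtoℚ-* (x ℕ.* y) z) (cong (_* ℕtoℚ z) (ℕtoℚ-* x y))

  expectation-bound-ℕ : ∀ (c ε : ℚ) → 0ℚ < ε → ∀ b .{{_ : ℕ.NonZero b}} μ m d n (f : Vec Bool n → ℕ) →
    ℕtoℚ m ≡ (½ + c) * ℕtoℚ μ → ℕtoℚ d ≤ ε * (+ 1 / 4) * ℕtoℚ μ →
    2 ℕ.* b ℕ.* μ ℕ.* 2 ℕ.^ n ℕ.≤ 4 ℕ.* (b ℕ.+ 1) ℕ.* ∑ˡ f (allVecs n) ℕ.+ (4 ℕ.* m ℕ.+ 2 ℕ.* b ℕ.* d ℕ.+ 3 ℕ.* b ℕ.* m) ℕ.* 2 ℕ.^ n →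
    (+ b / suc b) * (((+ 1 / 4) * (½ - (+ 3 / 1) * c)) - ((+ 1 / b) * (½ + c)) - ((+ 7 / 8) * ε)) * ℕtoℚ μ
      ≤ Expect n (λ σ → ℕtoℚ (f σ))
  expectation-bound-ℕ c ε 0<ε b μ m d n f m≡ d≤ counting =
    subst (_ ≤_) (cong (powℚ ½ n *_) (sym (sumℚ-ℕtoℚ f (allVecs n)))) $
    expectation-bound (+ b / suc b) (+ 1 / b) c ε (ℕtoℚ b) (ℕtoℚ μ) (ℕtoℚ m) (ℕtoℚ d) (ℕtoℚ S) (ℕtoℚ N) (powℚ ½ n)
      β≡ (1/b*b≡1 b) (sym m≡) (½^n*2^n≡1 n) (ℕtoℚ-nonNeg b) (ℕtoℚ-nonNeg μ) (<⇒≤ 0<ε) (½^n-nonNeg n) d≤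
      (subst₂ _≤_ lhs≡ rhs≡ (ℕtoℚ-mono-≤ counting))
    where
    S N : ℕ
    S = ∑ˡ f (allVecs n)
    N = 2 ℕ.^ n
    β≡ : (+ b / suc b) * (ℕtoℚ b + 1ℚ) ≡ ℕtoℚ b
    β≡ = trans (cong ((+ b / suc b) *_) (trans (sym (ℕtoℚ-+ b 1)) (cong ℕtoℚ (ℕ.+-comm b 1)))) (a/d*d≡a b b)
    lhs≡ : ℕtoℚ (2 ℕ.* b ℕ.* μ ℕ.* N) ≡ (+ 2 / 1) * ℕtoℚ b * ℕtoℚ μ * ℕtoℚ N
    lhs≡ = trans (ℕtoℚ-* (2 ℕ.* b ℕ.* μ) N) (cong (_* ℕtoℚ N) (ℕtoℚ-*³ 2 b μ))
    rhs≡ : ℕtoℚ (4 ℕ.* (b ℕ.+ 1) ℕ.* S ℕ.+ (4 ℕ.* m ℕ.+ 2 ℕ.* b ℕ.* d ℕ.+ 3 ℕ.* b ℕ.* m) ℕ.* N)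
           ≡ (+ 4 / 1) * (ℕtoℚ b + 1ℚ) * ℕtoℚ S
             + ((+ 4 / 1) * ℕtoℚ m + (+ 2 / 1) * ℕtoℚ b * ℕtoℚ d + (+ 3 / 1) * ℕtoℚ b * ℕtoℚ m) * ℕtoℚ N
    rhs≡ = begin
      ℕtoℚ (4 ℕ.* (b ℕ.+ 1) ℕ.* S ℕ.+ (4 ℕ.* m ℕ.+ 2 ℕ.* b ℕ.* d ℕ.+ 3 ℕ.* b ℕ.* m) ℕ.* N)
        ≡⟨ ℕtoℚ-+ (4 ℕ.* (b ℕ.+ 1) ℕ.* S) ((4 ℕ.* m ℕ.+ 2 ℕ.* b ℕ.* d ℕ.+ 3 ℕ.* b ℕ.* m) ℕ.* N) ⟩
      ℕtoℚ (4 ℕ.* (b ℕ.+ 1) ℕ.* S) + ℕtoℚ ((4 ℕ.* m ℕ.+ 2 ℕ.* b ℕ.* d ℕ.+ 3 ℕ.* b ℕ.* m) ℕ.* N)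
        ≡⟨ cong₂ _+_ (trans (ℕtoℚ-*³ 4 (b ℕ.+ 1) S) (cong (λ q → ℕtoℚ 4 * q * ℕtoℚ S) (ℕtoℚ-+ b 1)))
                     (trans (ℕtoℚ-* (4 ℕ.* m ℕ.+ 2 ℕ.* b ℕ.* d ℕ.+ 3 ℕ.* b ℕ.* m) N) (cong (_* ℕtoℚ N) (trans (ℕtoℚ-+ (4 ℕ.* m ℕ.+ 2 ℕ.* b ℕ.* d) (3 ℕ.* b ℕ.* m))
                        (cong₂ _+_ (trans (ℕtoℚ-+ (4 ℕ.* m) (2 ℕ.* b ℕ.* d)) (cong₂ _+_ (ℕtoℚ-* 4 m) (ℕtoℚ-*³ 2 b d))) (ℕtoℚ-*³ 3 b m))))) ⟩
      (+ 4 / 1) * (ℕtoℚ b + 1ℚ) * ℕtoℚ S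
        + ((+ 4 / 1) * ℕtoℚ m + (+ 2 / 1) * ℕtoℚ b * ℕtoℚ d + (+ 3 / 1) * ℕtoℚ b * ℕtoℚ m) * ℕtoℚ N ∎
      where open ≡-Reasoning

open import Defs
open import Data.Bool using (Bool)
open import Data.Nat using (ℕ; suc; NonZero)
open import Data.Integer using (+_)
open import Data.Rational using (ℚ; _/_; _<_; _≤_; _+_; _-_; _*_; 0ℚ; ½)
open import Data.List using (List; length)
open import Data.Vec using (Vec)
open import Data.Product using (Σ; _×_)
open import Relation.Binary.PropositionalEquality using (_≡_)

open Sums using (∑ˡ)
open FreePartnerAnalysis
open Counting
open Rationals
open import Data.Nat using (_^_) renaming (_≤_ to _≤ℕ_; _*_ to _*ℕ_)
open import Data.Product using (_,_)
open import Data.Fin.Subset using (∣_∣)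
open import Relation.Binary.PropositionalEquality using (subst)

lemma4p1 : ∀ {n} (G : Graph n) (μ : ℕ) → IsMaxMatchingSize G μ →
    (ε : ℚ) → 0ℚ < ε → (b : ℕ) → .{{_ : NonZero b}} →
    (M₁ : List (Edge n)) → IsApproxMaximal G μ (ε * (+ 1 / 4)) M₁ →
    (c : ℚ) → ℕtoℚ (length M₁) ≡ (½ + c) * ℕtoℚ μ →
    (M₂ : Vec Bool n → List (Edge n)) →
    (∀ σ → IsMaximalBMatching G M₁ b σ (M₂ σ)) →
    Σ (Vec Bool n → List (Path3 n)) λ P →
      (∀ σ → IsAugFamily M₁ (M₂ σ) (P σ)) ×
      ((+ b / suc b) * (((+ 1 / 4) * (½ - (+ 3 / 1) * c)) - ((+ 1 / b) * (½ + c))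
          - ((+ 7 / 8) * ε)) * ℕtoℚ μ
        ≤ Expect n (λ σ → ℕtoℚ (length (P σ))))
lemma4p1 {n} G μ ((M* , M*-matching , ∣M*∣≡μ) , _) ε 0<ε b M₁ (M₁-matching , D , ∣D∣≤ , _ , maximal-off-D)
         c ∣M₁∣≡ M₂ M₂-maximal =
  paths , (λ σ → Round.paths-family b σ (M₂ σ) (M₂-maximal σ)) ,
  expectation-bound-ℕ c ε 0<ε b μ (length M₁) ∣ D ∣ n (λ σ → length (paths σ)) ∣M₁∣≡ ∣D∣≤
    (counting-inequality b μ augmentable (∑ˡ (λ σ → ∑ˡ (good σ) M₁) (allVecs n)) S (length M₁) ∣ D ∣ (2 ^ n)
       (subst (λ k → 2 *ℕ k ≤ℕ _) ∣M*∣≡μ 2∣M*∣≤) expected-good b*∑∑good≤)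
  where
  open FreePartners G M₁ M₁-matching M* M*-matching
  open Tokens D maximal-off-D
  open Rounds b M₂ M₂-maximal
  S : ℕ
  S = ∑ˡ (λ σ → length (paths σ)) (allVecs n)
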